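{- Let $D\ge2$ be squarefree, $K=\mathbb{Q}(\sqrt D)$, $j\in\mathbb{Z}$, and $\alpha=4\beta_j$. Then: if $v_j\ge5$, $p_K(\alpha)=5$; if $v_j=4$, $p_K(\alpha)=6$; if $v_j=3$, $p_K(\alpha)\ge8$; if $v_j=2$, $p_K(\alpha)\ge16$.
   Context: $\mathcal{O}_K^+$: totally positive integers of $K$; $p_K(\alpha)$ is the number of unordered representations $\alpha=\lambda_1+\dots+\lambda_\ell$ ($\ell\ge1$, $\lambda_i\in\mathcal{O}_K^+$). Notation: $\omega_D=\sqrt D$, $\xi_D=\sqrt D$ if $D\equiv2,3\pmod4$; $\omega_D=(1+\sqrt D)/2$, $\xi_D=(\sqrt D-1)/2$ if $D\equiv1\pmod4$. Write $\omega_D=[\lceil u_0/2\rceil;\overline{u_1,\dots,u_s}]$ with $u_s=u_0$ (indices extended periodically). Let $p_{ -1}=1,q_{ -1}=0$, $p_0=\lceil u_0/2\rceil,q_0=1$, $p_{i+2}=u_{i+2}p_{i+1}+p_i$, $q_{i+2}=u_{i+2}q_{i+1}+q_i$, $\alpha_i=p_i+q_i\xi_D$, $\alpha_{i,r}=\alpha_i+r\alpha_{i+1}$. The indecomposables of $\mathcal{O}_K^+$ (elements not a sum of two elements of $\mathcal{O}_K^+$) are the $\alpha_{i,r}$ ($i\ge-1$ odd, $0\le r\le u_{i+2}-1$) and their Galois conjugates, ordered as $\dots<\beta_{ -1}<\beta_0=1<\beta_1<\dots$ with $\beta_{ -j}=\beta_j'$ ($\beta_j$, $j\ge0$, runs through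 the $\alpha_{i,r}$ in lexicographic order of $(i,r)$). For $j\in\mathbb{Z}$, $v_j=2$ if $\beta_{|j|}=\alpha_{i,r}$ with $1\le r\le u_{i+2}-1$, and $v_j=u_{i+1}+2$ if $\beta_{|j|}=\alpha_{i,0}$; one has $v_j\beta_j=\beta_{j-1}+\beta_{j+1}$. -}

module Defs where

open import Data.Bool using (Bool; true; false; if_then_else_)
open import Data.Nat as ℕ using (ℕ; zero; suc; _∸_; _≡ᵇ_; _<ᵇ_; _≤ᵇ_; _%_; _/_)
open import Data.Nat.Divisibility using (_∣_)
open import Data.Integer as ℤ using (ℤ; +_; -[1+_]; -_)
open import Data.Product using (Σ; ∃; _×_; _,_; proj₁)
open import Data.Sum using (_⊎_)
open import Data.List using (List; []; foldr)
open import Data.List.Relation.Unary.All using (All)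
open import Data.List.Relation.Binary.Permutation.Propositional using (_↭_)
open import Data.Fin using (Fin)
open import Relation.Binary.PropositionalEquality using (_≡_; _≢_)

SquareFree : ℕ → Set
SquareFree D = ∀ n → (n ℕ.* n) ∣ D → n ≡ 1

oneMod4 : ℕ → Bool
oneMod4 D = (D % 4) ≡ᵇ 1

isqrtFrom : ℕ → ℕ → ℕ
isqrtFrom n zero = zero
isqrtFrom n (suc k) = if (suc k ℕ.* suc k) ≤ᵇ n then suc k else isqrtFrom n k

isqrt : ℕ → ℕ
isqrt n = isqrtFrom n n

-- division, totalised by 0 for a zero divisor (never used with 0 below)
divℕ : ℕ → ℕ → ℕ
divℕ n zero = zero
divℕ n (suc q) = n / suc q

-- Continued fraction of ω_D, via complete quotients (P + √D)/Q
-- starting from √D = (0+√D)/1, resp. (1+√D)/2.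

cfState : ℕ → ℕ → ℕ × ℕ
cfState D zero = if oneMod4 D then (1 , 2) else (0 , 1)
cfState D (suc k) with cfState D k
... | (P , Q) =
  let a  = divℕ (P ℕ.+ isqrt D) Q
      P' = a ℕ.* Q ∸ P
  in (P' , divℕ (D ∸ P' ℕ.* P') Q)

cfA : ℕ → ℕ → ℕ
cfA D k with cfState D k
... | (P , Q) = divℕ (P ℕ.+ isqrt D) Q

-- u_k : u_0 = u_s (= 2⌊ω_D⌋ resp. 2⌊ω_D⌋-1), u_k = k-th partial quotient for k ≥ 1
u : ℕ → ℕ → ℕ
u D zero = if oneMod4 D then 2 ℕ.* cfA D 0 ∸ 1 else 2 ℕ.* cfA D 0
u D (suc k) = cfA D (suc k)

-- shifted convergents: Pc D n = p_{n-1}, Qc D n = q_{n-1}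
Pc : ℕ → ℕ → ℕ
Pc D zero = 1
Pc D (suc zero) = cfA D 0
Pc D (suc (suc n)) = u D (suc n) ℕ.* Pc D (suc n) ℕ.+ Pc D n

Qc : ℕ → ℕ → ℕ
Qc D zero = 0
Qc D (suc zero) = 1
Qc D (suc (suc n)) = u D (suc n) ℕ.* Qc D (suc n) ℕ.+ Qc D n

-- Elements of O_K = ℤ[ω_D], as pairs (x , y) meaning x + y ω_D.

OK : Set
OK = ℤ × ℤ

_⊕_ : OK → OK → OK
(a , b) ⊕ (c , d) = (a ℤ.+ c , b ℤ.+ d)

sumOK : List OK → OK
sumOK = foldr _⊕_ (+ 0 , + 0)

scale : ℕ → OK → OK
scale n (x , y) = (+ n ℤ.* x , + n ℤ.* y)

conj : ℕ → OK → OK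
conj D (x , y) = if oneMod4 D then (x ℤ.+ y , - y) else (x , - y)

-- from coordinates in basis (1, ξ_D) to basis (1, ω_D)
fromXi : ℕ → ℤ → ℤ → OK
fromXi D a b = if oneMod4 D then (a ℤ.- b , b) else (a , b)

-- α_{2k-1, r} = α_{2k-1} + r α_{2k},  α_i = p_i + q_i ξ_D
alphaIR : ℕ → ℕ × ℕ → OK
alphaIR D (k , r) =
  fromXi D (+ (Pc D (2 ℕ.* k) ℕ.+ r ℕ.* Pc D (suc (2 ℕ.* k))))
           (+ (Qc D (2 ℕ.* k) ℕ.+ r ℕ.* Qc D (suc (2 ℕ.* k))))

-- (k , r) such that β_n = α_{2k-1,r}, lexicographic enumeration with 0 ≤ r ≤ u_{2k+1} - 1
betaIdx : ℕ → ℕ → ℕ × ℕ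
betaIdx D zero = (0 , 0)
betaIdx D (suc n) with betaIdx D n
... | (k , r) = if suc r <ᵇ u D (suc (2 ℕ.* k)) then (k , suc r) else (suc k , 0)

beta : ℕ → ℤ → OK
beta D (+ n) = alphaIR D (betaIdx D n)
beta D -[1+ n ] = conj D (alphaIR D (betaIdx D (suc n)))

v : ℕ → ℤ → ℕ
v D j with betaIdx D (ℤ.∣ j ∣)
... | (k , r) = if r ≡ᵇ 0 then u D (2 ℕ.* k) ℕ.+ 2 else 2

-- Total positivity.  a + b√D > 0  (D not a square).
PosSurd : ℕ → ℤ → ℤ → Set
PosSurd D a b =
    (+ 0 ℤ.< a × b ℤ.* b ℤ.* + D ℤ.< a ℤ.* a)
  ⊎ (+ 0 ℤ.< b × a ℤ.* a ℤ.< b ℤ.* b ℤ.* + D)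
  ⊎ (+ 0 ℤ.< a × + 0 ℤ.< b)

-- (x + y ω_D) written as (a + b √D)/c with c ∈ {1,2}: returns (a , b)
surd : ℕ → OK → ℤ × ℤ
surd D (x , y) = if oneMod4 D then (+ 2 ℤ.* x ℤ.+ y , y) else (x , y)

TotPos : ℕ → OK → Set
TotPos D z with surd D z
... | (a , b) = PosSurd D a b × PosSurd D a (- b)

-- Representations α = λ₁ + … + λ_ℓ, ℓ ≥ 1, λ_i ∈ O_K^+ (as lists; unordered = up to ↭)

Rep : ℕ → OK → Set
Rep D α = Σ (List OK) λ l → (l ≢ []) × All (TotPos D) l × sumOK l ≡ α

PartCount : ℕ → OK → ℕ → Set
PartCount D α n =
  Σ (Fin n → Rep D α) λ f →
    (∀ i j → proj₁ (f i) ↭ proj₁ (f j) → i ≡ j) ×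
    (∀ (ρ : Rep D α) → ∃ λ i → proj₁ ρ ↭ proj₁ (f i))

PartAtLeast : ℕ → OK → ℕ → Set
PartAtLeast D α n =
  Σ (Fin n → Rep D α) λ f → ∀ i j → proj₁ (f i) ↭ proj₁ (f j) → i ≡ j

-- Three consecutive indecomposables L = β_{j-1}, B = β_j, R = β_{j+1} satisfy L + R = v_j B,
-- det (B , R) = 1, and R - B, B - L are positive with negative conjugates; all of this comes from
-- the continued fraction of ω_D, whose convergents have norms of alternating sign.
--
-- Write every element as x B + y R. A totally positive summand then has positive coefficient sums
-- s = x + y in the basis (B , R) and t = x + (v - 1) y in the basis (L , B), because R - B and
-- B - L each give a linear form that is positive on totally positive elements and takes equal
-- values on the two basis vectors. A representation 4 B = λ₁ + … + λ_ℓ thus yields weights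
-- (s_i , t_i) ≥ (1 , 1) summing to (4 , 4) with t_i - s_i = (v - 2) y_i. For v ≥ 4 this forces
-- either all y_i = 0, i.e. a partition of 4 times B, or v = 4 and {λ_i} = {L , R}: exactly 5
-- resp. 6 representations. For v = 3 and v = 2 one lists 8 resp. 16 sums of copies of L, B, R
-- and tells them apart by a permutation-invariant fingerprint.

module Submission where

open import Data.Bool using (true; false; if_then_else_; T)
open import Data.Empty using (⊥-elim)
open import Data.Fin as Fin using (Fin; zero; suc)
import Data.Fin.Properties as Finₚ
open import Data.Integer as ℤ using (ℤ; +_; -[1+_]; -_; _+_; _*_; _-_; _<_; _≤_; +<+; +≤+; 0ℤ; 1ℤ; -1ℤ; _^_)
import Data.Integer.Properties as ℤₚ
open import Data.Integer.Tactic.RingSolver using (solve-∀)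
open import Data.List using (List; []; _∷_; map)
open import Data.List.NonEmpty as List⁺ using (List⁺; _∷_; toList)
open import Data.List.Properties using (map-∘; map-cong; map-id; map-id-local)
open import Data.List.Relation.Unary.All as All using (All; []; _∷_; all?)
import Data.List.Relation.Unary.All.Properties as All
open import Data.List.Relation.Unary.Any using (Any; here; there)
open import Data.List.Relation.Binary.Permutation.Propositional using (_↭_; ↭-refl; ↭-trans; ↭-reflexive; prep; swap)
open import Data.List.Relation.Binary.Permutation.Propositional.Properties using (All-resp-↭; map⁺)
open import Data.Nat as ℕ using (ℕ; zero; suc; z≤n; s≤s; _∸_; _/_; _%_)
import Data.Nat.Properties as ℕₚ
import Data.Nat.DivMod as ℕ
open import Data.Nat.Divisibility using (divides; ∣⇒≤)
open import Data.Nat.ListAction using (sum)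
open import Data.Nat.ListAction.Properties using (sum-↭)
import Data.Nat.Tactic.RingSolver as ℕ-Ring
open import Data.Product using (∃; ∃₂; _×_; _,_; proj₁; proj₂)
import Data.Product.Properties as Productₚ
open import Data.Sum using (_⊎_; inj₁; inj₂)
open import Relation.Binary using (tri<; tri≈; tri>)
open import Relation.Binary.PropositionalEquality using (_≡_; _≢_; refl; sym; trans; cong; cong₂; subst; subst₂; module ≡-Reasoning)
open import Relation.Nullary using (Dec; yes; no; contradiction; _×-dec_; _→-dec_)
open import Relation.Nullary.Decidable using (from-yes)
open import Defs

-- Surds a + b √D

*-pos : ∀ {a b} → 0ℤ < a → 0ℤ < b → 0ℤ < a * b
*-pos {+ suc m} {+ suc n} _ _ = +<+ (s≤s z≤n)
*-pos {+ zero} (+<+ ())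
*-pos {+ suc m} {+ zero} _ (+<+ ())

*-nonNeg : ∀ {a b} → 0ℤ ≤ a → 0ℤ ≤ b → 0ℤ ≤ a * b
*-nonNeg {+ m} {+ n} _ _ = subst (0ℤ ≤_) (ℤₚ.pos-* m n) (+≤+ z≤n)

0<⇒1≤∣∣ : ∀ {i} → 0ℤ < i → 1 ℕ.≤ ℤ.∣ i ∣
0<⇒1≤∣∣ (+<+ 0<n) = 0<n

0<⇒+∣∣≡ : ∀ {i} → 0ℤ < i → + ℤ.∣ i ∣ ≡ i
0<⇒+∣∣≡ 0<i = ℤₚ.0≤i⇒+∣i∣≡i (ℤₚ.<⇒≤ 0<i)

i<j⇒0<j-i : ∀ {i j} → i < j → 0ℤ < j - i
i<j⇒0<j-i {i} {j} i<j = subst (_< j - i) (ℤₚ.+-inverseʳ i) (ℤₚ.+-monoˡ-< (- i) i<j)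

0<j-i⇒i<j : ∀ {i j} → 0ℤ < j - i → i < j
0<j-i⇒i<j {i} {j} 0<j-i = subst₂ _<_ (ℤₚ.+-identityˡ i) (e i j) (ℤₚ.+-monoˡ-< i 0<j-i)
  where
  e : ∀ i j → j - i + i ≡ j
  e = solve-∀

square-nonNeg : ∀ a → 0ℤ ≤ a * a
square-nonNeg (+ n) = *-nonNeg {+ n} (+≤+ z≤n) (+≤+ z≤n)
square-nonNeg -[1+ n ] = +≤+ z≤n

*-mono-<-nonNeg : ∀ {a b c d} → 0ℤ ≤ a → a < b → 0ℤ ≤ c → c < d → a * c < b * d
*-mono-<-nonNeg {a} {b} {c} {d} 0≤a a<b 0≤c c<d = ℤₚ.≤-<-trans
  (ℤₚ.*-monoˡ-≤-nonNeg a {{ℤ.nonNegative 0≤a}} (ℤₚ.<⇒≤ c<d))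
  (ℤₚ.*-monoʳ-<-pos d {{ℤ.positive (ℤₚ.≤-<-trans 0≤c c<d)}} a<b)

square-cancel-< : ∀ {a b} → 0ℤ ≤ b → a * a < b * b → a < b
square-cancel-< {a} {b} 0≤b a²<b² with ℤₚ.<-cmp a b
... | tri< a<b _ _ = a<b
... | tri≈ _ refl _ = ⊥-elim (ℤₚ.<-irrefl refl a²<b²)
... | tri> _ _ b<a = ⊥-elim (ℤₚ.<-asym a²<b² (*-mono-<-nonNeg 0≤b b<a 0≤b b<a))

neg-square : ∀ b → (- b) * (- b) ≡ b * b
neg-square = solve-∀

pos-∸ : ∀ {m n} → n ℕ.≤ m → + (m ∸ n) ≡ + m - + n
pos-∸ {m} {n} n≤m = sym (trans (ℤₚ.[+m]-[+n]≡m⊖n m n) (ℤₚ.⊖-≥ n≤m))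

record TotPosSurd (D : ℕ) (a b : ℤ) : Set where
  constructor _,_
  field
    pos : 0ℤ < a
    norm : b * b * + D < a * a

-- p + q√D > 0 > p - q√D
record MixedSurd (D : ℕ) (p q : ℤ) : Set where
  constructor _,_
  field
    pos : 0ℤ < q
    norm : p * p < q * q * + D

module _ {D : ℕ} where

  TotPosSurd-+ : ∀ {a₁ b₁ a₂ b₂} → TotPosSurd D a₁ b₁ → TotPosSurd D a₂ b₂ →
                 TotPosSurd D (a₁ + a₂) (b₁ + b₂)
  TotPosSurd-+ {a₁} {b₁} {a₂} {b₂} (0<a₁ , n₁) (0<a₂ , n₂) =
    ℤₚ.+-mono-< 0<a₁ 0<a₂ ,
    subst₂ _<_ (sq b₁ b₂ (+ D)) (sq′ a₁ a₂) (ℤₚ.+-mono-< (ℤₚ.+-mono-< n₁ n₂) (ℤₚ.+-mono-< cross cross))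
    where
    norm-nonNeg : ∀ b → 0ℤ ≤ b * b * + D
    norm-nonNeg b = *-nonNeg (square-nonNeg b) (+≤+ z≤n)
    cross : b₁ * b₂ * + D < a₁ * a₂
    cross = square-cancel-< (ℤₚ.<⇒≤ (*-pos 0<a₁ 0<a₂))
      (subst₂ _<_ (e b₁ b₂ (+ D)) (e′ a₁ a₂) (*-mono-<-nonNeg (norm-nonNeg b₁) n₁ (norm-nonNeg b₂) n₂))
      where
      e : ∀ b₁ b₂ d → (b₁ * b₁ * d) * (b₂ * b₂ * d) ≡ (b₁ * b₂ * d) * (b₁ * b₂ * d)
      e = solve-∀
      e′ : ∀ a₁ a₂ → (a₁ * a₁) * (a₂ * a₂) ≡ (a₁ * a₂) * (a₁ * a₂)
      e′ = solve-∀
    sq : ∀ b₁ b₂ d → b₁ * b₁ * d + b₂ * b₂ * d + (b₁ * b₂ * d + b₁ * b₂ * d) ≡ (b₁ + b₂) * (b₁ + b₂) * d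
    sq = solve-∀
    sq′ : ∀ a₁ a₂ → a₁ * a₁ + a₂ * a₂ + (a₁ * a₂ + a₁ * a₂) ≡ (a₁ + a₂) * (a₁ + a₂)
    sq′ = solve-∀

  private
    scale-norm : ∀ n b → n * n * (b * b * + D) ≡ n * b * (n * b) * + D
    scale-norm n b = e n b (+ D)
      where
      e : ∀ n b d → n * n * (b * b * d) ≡ n * b * (n * b) * d
      e = solve-∀
    scale-square : ∀ n a → n * n * (a * a) ≡ n * a * (n * a)
    scale-square = solve-∀

  TotPosSurd-* : ∀ {n a b} → 0ℤ < n → TotPosSurd D a b → TotPosSurd D (n * a) (n * b)
  TotPosSurd-* {n} {a} {b} 0<n (0<a , N) =
    *-pos 0<n 0<a , subst₂ _<_ (scale-norm n b) (scale-square n a) (ℤₚ.*-monoˡ-<-pos (n * n) {{ℤ.positive (*-pos 0<n 0<n)}} N)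

  TotPosSurd-*⁻¹ : ∀ {n a b} → 0ℤ < n → TotPosSurd D (n * a) (n * b) → TotPosSurd D a b
  TotPosSurd-*⁻¹ {n} {a} {b} 0<n (0<na , N) =
    ℤₚ.*-cancelˡ-<-nonNeg n {{ℤ.nonNegative (ℤₚ.<⇒≤ 0<n)}} (subst (_< n * a) (sym (ℤₚ.*-zeroʳ n)) 0<na) ,
    ℤₚ.*-cancelˡ-<-nonNeg (n * n) {{ℤ.nonNegative (square-nonNeg n)}} (subst₂ _<_ (sym (scale-norm n b)) (sym (scale-square n a)) N)

  TotPosSurd-neg : ∀ {a b} → TotPosSurd D a b → TotPosSurd D a (- b)
  TotPosSurd-neg {a} {b} (0<a , N) = 0<a , subst (λ c → c * + D < a * a) (sym (neg-square b)) N

  MixedSurd-neg : ∀ {p q} → MixedSurd D p q → MixedSurd D (- p) q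
  MixedSurd-neg {p} {q} (0<q , N) = 0<q , subst (_< q * q * + D) (sym (neg-square p)) N

  -- The functional (a, b) ↦ q a - p b is positive on the totally positive cone:
  -- compare p² b² D with q² D a².
  MixedSurd-cross : ∀ {p q a b} → MixedSurd D p q → TotPosSurd D a b → p * b < q * a
  MixedSurd-cross {p} {q} {a} {b} (0<q , M) (0<a , N) =
    square-cancel-< (ℤₚ.<⇒≤ (*-pos 0<q 0<a))
      (ℤₚ.*-cancelˡ-<-nonNeg (+ D) (subst₂ _<_ (e p b (+ D)) (e′ q a (+ D))
        (*-mono-<-nonNeg (square-nonNeg p) M (*-nonNeg (square-nonNeg b) (+≤+ z≤n)) N)))
    where
    e : ∀ p b d → (p * p) * (b * b * d) ≡ d * (p * b * (p * b))
    e = solve-∀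
    e′ : ∀ q a d → (q * q * d) * (a * a) ≡ d * (q * a * (q * a))
    e′ = solve-∀

-- Arithmetic in ℤ[ω_D]

-- ω_D = (P₀ + √D) / Q₀
P₀ Q₀ : ℕ → ℕ
P₀ D = proj₁ (cfState D 0)
Q₀ D = proj₂ (cfState D 0)

-- x + y ω_D = (rat D (x , y) + y √D) / Q₀
rat : ℕ → OK → ℤ
rat D (x , y) = + Q₀ D * x + + P₀ D * y

infix 20 _⊖_
infixr 25 _·_

_·_ : ℤ → OK → OK
n · (x , y) = (n * x , n * y)

_⊖_ : OK → OK → OK
(a , b) ⊖ (c , d) = (a - c , b - d)

𝟘 : OK
𝟘 = (0ℤ , 0ℤ)

⊕-identityˡ : ∀ z → 𝟘 ⊕ z ≡ z
⊕-identityˡ (x , y) = cong₂ _,_ (ℤₚ.+-identityˡ x) (ℤₚ.+-identityˡ y)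

⊕-identityʳ : ∀ z → z ⊕ 𝟘 ≡ z
⊕-identityʳ (x , y) = cong₂ _,_ (ℤₚ.+-identityʳ x) (ℤₚ.+-identityʳ y)

·-zeroˡ : ∀ z → 0ℤ · z ≡ 𝟘
·-zeroˡ (x , y) = cong₂ _,_ (ℤₚ.*-zeroˡ x) (ℤₚ.*-zeroˡ y)

⊕-comm : ∀ z w → z ⊕ w ≡ w ⊕ z
⊕-comm (x , y) (x′ , y′) = cong₂ _,_ (ℤₚ.+-comm x x′) (ℤₚ.+-comm y y′)

⊕-⊖ : ∀ z w → (z ⊕ w) ⊖ w ≡ z
⊕-⊖ (x , y) (x′ , y′) = cong₂ _,_ (e x x′) (e y y′)
  where
  e : ∀ a b → a + b - b ≡ a
  e = solve-∀

det : OK → OK → ℤ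
det (a , b) (c , d) = a * d - b * c

det-left : ∀ {v L B R} → L ⊕ R ≡ scale v B → det L B ≡ det B R
det-left {v} {L} {B} {R} L⊕R = trans (cong (λ L → det L B) L≡) (e (+ v) (proj₁ B) (proj₂ B) (proj₁ R) (proj₂ R))
  where
  L≡ : L ≡ scale v B ⊖ R
  L≡ = trans (sym (⊕-⊖ L R)) (cong (_⊖ R) L⊕R)
  e : ∀ v b₁ b₂ r₁ r₂ → (v * b₁ - r₁) * b₂ - (v * b₂ - r₂) * b₁ ≡ b₁ * r₂ - b₂ * r₁
  e = solve-∀

surd-≡ : ∀ D z → surd D z ≡ (rat D z , proj₂ z)
surd-≡ D (x , y) with oneMod4 D
... | true = cong (_, y) (e x y)
  where
  e : ∀ x y → + 2 * x + y ≡ + 2 * x + + 1 * y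
  e = solve-∀
... | false = cong (_, y) (e x y)
  where
  e : ∀ x y → x ≡ + 1 * x + + 0 * y
  e = solve-∀

conj-≡ : ∀ D z → conj D z ≡ (proj₁ z + + P₀ D * proj₂ z , - proj₂ z)
conj-≡ D (x , y) with oneMod4 D
... | true = cong (_, - y) (cong (_+_ x) (sym (ℤₚ.*-identityˡ y)))
... | false = cong (_, - y) (sym (trans (cong (_+_ x) (ℤₚ.*-zeroˡ y)) (ℤₚ.+-identityʳ x)))

conj-⊕ : ∀ D z w → conj D (z ⊕ w) ≡ conj D z ⊕ conj D w
conj-⊕ D z@(x , y) w@(x′ , y′) = trans (conj-≡ D (z ⊕ w))
  (trans (cong₂ _,_ (e x y x′ y′ (+ P₀ D)) (ℤₚ.neg-distrib-+ y y′)) (sym (cong₂ _⊕_ (conj-≡ D z) (conj-≡ D w))))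
  where
  e : ∀ x y x′ y′ p → x + x′ + p * (y + y′) ≡ x + p * y + (x′ + p * y′)
  e = solve-∀

conj-· : ∀ D n z → conj D (n · z) ≡ n · conj D z
conj-· D n z@(x , y) = trans (conj-≡ D (n · z))
  (trans (cong₂ _,_ (e n x y (+ P₀ D)) (ℤₚ.neg-distribʳ-* n y)) (sym (cong (n ·_) (conj-≡ D z))))
  where
  e : ∀ n x y p → n * x + p * (n * y) ≡ n * (x + p * y)
  e = solve-∀

det-conj : ∀ D z w → det (conj D z) (conj D w) ≡ det w z
det-conj D z w = trans (cong₂ det (conj-≡ D z) (conj-≡ D w)) (e (proj₁ z) (proj₂ z) (proj₁ w) (proj₂ w) (+ P₀ D))
  where
  e : ∀ x y x′ y′ p → (x + p * y) * - y′ - - y * (x′ + p * y′) ≡ x′ * y - y′ * x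
  e = solve-∀

rat-⊕ : ∀ D z w → rat D (z ⊕ w) ≡ rat D z + rat D w
rat-⊕ D (x , y) (x′ , y′) = e (+ Q₀ D) (+ P₀ D) x y x′ y′
  where
  e : ∀ q p x y x′ y′ → q * (x + x′) + p * (y + y′) ≡ q * x + p * y + (q * x′ + p * y′)
  e = solve-∀

rat-· : ∀ D n z → rat D (n · z) ≡ n * rat D z
rat-· D n (x , y) = e (+ Q₀ D) (+ P₀ D) n x y
  where
  e : ∀ q p n x y → q * (n * x) + p * (n * y) ≡ n * (q * x + p * y)
  e = solve-∀

rat-⊖ : ∀ D z w → rat D (z ⊖ w) ≡ rat D z - rat D w
rat-⊖ D (x , y) (x′ , y′) = e (+ Q₀ D) (+ P₀ D) x y x′ y′
  where
  e : ∀ q p x y x′ y′ → q * (x - x′) + p * (y - y′) ≡ q * x + p * y - (q * x′ + p * y′)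
  e = solve-∀

rat-conj : ∀ D z → rat D (conj D z) ≡ rat D z
rat-conj D (x , y) with oneMod4 D
... | true = e x y
  where
  e : ∀ x y → + 2 * (x + y) + + 1 * - y ≡ + 2 * x + + 1 * y
  e = solve-∀
... | false = e x y
  where
  e : ∀ x y → + 1 * x + + 0 * - y ≡ + 1 * x + + 0 * y
  e = solve-∀

fromXi-≡ : ∀ D x y → fromXi D x y ≡ (x - + P₀ D * y , y)
fromXi-≡ D x y with oneMod4 D
... | true = cong (_, y) (cong (_-_ x) (sym (ℤₚ.*-identityˡ y)))
... | false = cong (_, y) (sym (trans (cong (_-_ x) (ℤₚ.*-zeroˡ y)) (ℤₚ.+-identityʳ x)))

rat-fromXi : ∀ D x y → rat D (fromXi D x y) ≡ + Q₀ D * x - + P₀ D * y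
rat-fromXi D x y with oneMod4 D
... | true = e x y
  where
  e : ∀ x y → + 2 * (x - y) + + 1 * y ≡ + 2 * x - + 1 * y
  e = solve-∀
... | false = e x y
  where
  e : ∀ x y → + 1 * x + + 0 * y ≡ + 1 * x - + 0 * y
  e = solve-∀

det-fromXi : ∀ D x y x′ y′ → det (fromXi D x y) (fromXi D x′ y′) ≡ x * y′ - y * x′
det-fromXi D x y x′ y′ = trans (cong₂ det (fromXi-≡ D x y) (fromXi-≡ D x′ y′)) (e x y x′ y′ (+ P₀ D))
  where
  e : ∀ x y x′ y′ p → (x - p * y) * y′ - y * (x′ - p * y′) ≡ x * y′ - y * x′
  e = solve-∀

fromXi-⊕ : ∀ D x y x′ y′ → fromXi D x y ⊕ fromXi D x′ y′ ≡ fromXi D (x + x′) (y + y′)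
fromXi-⊕ D x y x′ y′ = trans (cong₂ _⊕_ (fromXi-≡ D x y) (fromXi-≡ D x′ y′))
  (trans (cong (_, y + y′) (e x y x′ y′ (+ P₀ D))) (sym (fromXi-≡ D (x + x′) (y + y′))))
  where
  e : ∀ x y x′ y′ p → x - p * y + (x′ - p * y′) ≡ x + x′ - p * (y + y′)
  e = solve-∀

fromXi-⊖ : ∀ D x y x′ y′ → fromXi D x′ y′ ⊖ fromXi D x y ≡ fromXi D (x′ - x) (y′ - y)
fromXi-⊖ D x y x′ y′ = trans (cong₂ _⊖_ (fromXi-≡ D x′ y′) (fromXi-≡ D x y))
  (trans (cong (_, y′ - y) (e x y x′ y′ (+ P₀ D))) (sym (fromXi-≡ D (x′ - x) (y′ - y))))
  where
  e : ∀ x y x′ y′ p → x′ - p * y′ - (x - p * y) ≡ x′ - x - p * (y′ - y)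
  e = solve-∀

fromXi-· : ∀ D n x y → n · fromXi D x y ≡ fromXi D (n * x) (n * y)
fromXi-· D n x y = trans (cong (n ·_) (fromXi-≡ D x y))
  (trans (cong (_, n * y) (e n x y (+ P₀ D))) (sym (fromXi-≡ D (n * x) (n * y))))
  where
  e : ∀ n x y p → n * (x - p * y) ≡ n * x - p * (n * y)
  e = solve-∀

-- Total positivity

Mixed : ℕ → OK → Set
Mixed D z = MixedSurd D (rat D z) (proj₂ z)

module _ (D : ℕ) where

  private
    TotPosSurd⊎pos : ∀ {a b} → PosSurd D a b → TotPosSurd D a b ⊎ 0ℤ < b
    TotPosSurd⊎pos (inj₁ (0<a , n)) = inj₁ (0<a , n)
    TotPosSurd⊎pos (inj₂ (inj₁ (0<b , _))) = inj₂ 0<b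
    TotPosSurd⊎pos (inj₂ (inj₂ (_ , 0<b))) = inj₂ 0<b

    fromPosSurd : ∀ {a b} → PosSurd D a b → PosSurd D a (- b) → TotPosSurd D a b
    fromPosSurd {a} {b} p q with TotPosSurd⊎pos p | TotPosSurd⊎pos q
    ... | inj₁ t | _ = t
    ... | _ | inj₁ t = subst (TotPosSurd D a) (ℤₚ.neg-involutive b) (TotPosSurd-neg t)
    ... | inj₂ 0<b | inj₂ 0<-b = ⊥-elim (ℤₚ.<-asym 0<b (subst (_< 0ℤ) (ℤₚ.neg-involutive b) (ℤₚ.neg-mono-< 0<-b)))

    TotPos-surd : OK → Set
    TotPos-surd w = PosSurd D (proj₁ w) (proj₂ w) × PosSurd D (proj₁ w) (- proj₂ w)

  TotPos⇒TotPosSurd : ∀ z → TotPos D z → TotPosSurd D (rat D z) (proj₂ z)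
  TotPos⇒TotPosSurd z tp with subst TotPos-surd (surd-≡ D z) tp
  ... | p , q = fromPosSurd p q

  TotPosSurd⇒TotPos : ∀ z → TotPosSurd D (rat D z) (proj₂ z) → TotPos D z
  TotPosSurd⇒TotPos z t = subst TotPos-surd (sym (surd-≡ D z)) (posSurd t , posSurd (TotPosSurd-neg t))
    where
    posSurd : ∀ {a b} → TotPosSurd D a b → PosSurd D a b
    posSurd (0<a , n) = inj₁ (0<a , n)

  TotPos-⊕ : ∀ z w → TotPos D z → TotPos D w → TotPos D (z ⊕ w)
  TotPos-⊕ z w tz tw = TotPosSurd⇒TotPos (z ⊕ w)
    (subst (λ a → TotPosSurd D a (proj₂ z + proj₂ w)) (sym (rat-⊕ D z w))
      (TotPosSurd-+ (TotPos⇒TotPosSurd z tz) (TotPos⇒TotPosSurd w tw)))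

  TotPos-· : ∀ {n} z → 0ℤ < n → TotPos D z → TotPos D (n · z)
  TotPos-· {n} z 0<n tz = TotPosSurd⇒TotPos (n · z)
    (subst (λ a → TotPosSurd D a (n * proj₂ z)) (sym (rat-· D n z)) (TotPosSurd-* 0<n (TotPos⇒TotPosSurd z tz)))

  TotPos-conj : ∀ z → TotPos D z → TotPos D (conj D z)
  TotPos-conj z tz = TotPosSurd⇒TotPos (conj D z)
    (subst₂ (TotPosSurd D) (sym (rat-conj D z)) (sym (cong proj₂ (conj-≡ D z))) (TotPosSurd-neg (TotPos⇒TotPosSurd z tz)))

  Mixed-conj : ∀ P Q → Mixed D (Q ⊖ P) → Mixed D (conj D P ⊖ conj D Q)
  Mixed-conj P Q m = subst₂ (MixedSurd D) rat-eq y-eq (MixedSurd-neg m)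
    where
    rat-eq : - rat D (Q ⊖ P) ≡ rat D (conj D P ⊖ conj D Q)
    rat-eq = begin
      - rat D (Q ⊖ P)                      ≡⟨ cong -_ (rat-⊖ D Q P) ⟩
      - (rat D Q - rat D P)                ≡⟨ e (rat D Q) (rat D P) ⟩
      rat D P - rat D Q                    ≡⟨ sym (cong₂ _-_ (rat-conj D P) (rat-conj D Q)) ⟩
      rat D (conj D P) - rat D (conj D Q)  ≡⟨ sym (rat-⊖ D (conj D P) (conj D Q)) ⟩
      rat D (conj D P ⊖ conj D Q)          ∎
      where
      open ≡-Reasoning
      e : ∀ a b → - (a - b) ≡ b - a
      e = solve-∀
    y-eq : proj₂ (Q ⊖ P) ≡ proj₂ (conj D P ⊖ conj D Q)
    y-eq = trans (e (proj₂ Q) (proj₂ P)) (sym (cong₂ _-_ (cong proj₂ (conj-≡ D P)) (cong proj₂ (conj-≡ D Q))))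
      where
      e : ∀ a b → a - b ≡ - b - - a
      e = solve-∀

  -- φ z = q · rat z - p · y, with (p , q) the surd coordinates of Q ⊖ P, is positive on
  -- totally positive elements and takes the same value at P and Q; hence
  -- φ (x · P ⊕ y · Q) = (x + y) φ P forces x + y > 0.
  coeffSum-pos : ∀ P Q {x y} → TotPos D P → Mixed D (Q ⊖ P) → TotPos D (x · P ⊕ y · Q) → 0ℤ < x + y
  coeffSum-pos P Q {x} {y} tP m tl =
    ℤₚ.*-cancelʳ-<-nonNeg (φ P) {{ℤ.nonNegative (ℤₚ.<⇒≤ (φ-pos P tP))}}
      (subst₂ _<_ (sym (ℤₚ.*-zeroˡ (φ P))) φ-βcoeff (φ-pos (x · P ⊕ y · Q) tl))
    where
    p = rat D (Q ⊖ P)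
    q = proj₂ (Q ⊖ P)
    φ : OK → ℤ
    φ z = q * rat D z - p * proj₂ z
    φ-pos : ∀ z → TotPos D z → 0ℤ < φ z
    φ-pos z tz = i<j⇒0<j-i (MixedSurd-cross m (TotPos⇒TotPosSurd z tz))
    φ-βcoeff : φ (x · P ⊕ y · Q) ≡ (x + y) * φ P
    φ-βcoeff = begin
      q * rat D (x · P ⊕ y · Q) - p * (x * P₂ + y * Q₂)
        ≡⟨ cong₂ (λ r r′ → q * r - r′ * (x * P₂ + y * Q₂)) rat-lin (rat-⊖ D Q P) ⟩
      q * (x * rat D P + y * rat D Q) - (rat D Q - rat D P) * (x * P₂ + y * Q₂)
        ≡⟨ e x y (rat D P) (rat D Q) P₂ Q₂ ⟩
      (x + y) * (q * rat D P - (rat D Q - rat D P) * P₂)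
        ≡⟨ cong (λ r → (x + y) * (q * rat D P - r * P₂)) (sym (rat-⊖ D Q P)) ⟩
      (x + y) * φ P ∎
      where
      open ≡-Reasoning
      P₂ = proj₂ P
      Q₂ = proj₂ Q
      rat-lin : rat D (x · P ⊕ y · Q) ≡ x * rat D P + y * rat D Q
      rat-lin = trans (rat-⊕ D (x · P) (y · Q)) (cong₂ _+_ (rat-· D x P) (rat-· D y Q))
      e : ∀ x y rP rQ P₂ Q₂ → (Q₂ - P₂) * (x * rP + y * rQ) - (rQ - rP) * (x * P₂ + y * Q₂)
                               ≡ (x + y) * ((Q₂ - P₂) * rP - (rQ - rP) * P₂)
      e = solve-∀

TotNonNeg : ℕ → OK → Set
TotNonNeg D z = TotPos D z ⊎ z ≡ 𝟘

module _ (D : ℕ) where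

  TotNonNeg-⊕ : ∀ z w → TotNonNeg D z → TotNonNeg D w → TotNonNeg D (z ⊕ w)
  TotNonNeg-⊕ z w (inj₁ tz) (inj₁ tw) = inj₁ (TotPos-⊕ D z w tz tw)
  TotNonNeg-⊕ z w (inj₁ tz) (inj₂ refl) = inj₁ (subst (TotPos D) (sym (⊕-identityʳ z)) tz)
  TotNonNeg-⊕ z w (inj₂ refl) nw = subst (TotNonNeg D) (sym (⊕-identityˡ w)) nw

  TotNonNeg-· : ∀ n z → TotPos D z → TotNonNeg D ((+ n) · z)
  TotNonNeg-· zero z _ = inj₂ (·-zeroˡ z)
  TotNonNeg-· (suc n) z tz = inj₁ (TotPos-· D {+ suc n} z (+<+ (s≤s z≤n)) tz)

  TotPos-⊕ʳ : ∀ z w → TotPos D z → TotNonNeg D w → TotPos D (z ⊕ w)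
  TotPos-⊕ʳ z w tz (inj₁ tw) = TotPos-⊕ D z w tz tw
  TotPos-⊕ʳ z w tz (inj₂ refl) = subst (TotPos D) (sym (⊕-identityʳ z)) tz

  TotPos-⊕ˡ : ∀ z w → TotNonNeg D z → TotPos D w → TotPos D (z ⊕ w)
  TotPos-⊕ˡ z w (inj₁ tz) tw = TotPos-⊕ D z w tz tw
  TotPos-⊕ˡ z w (inj₂ refl) tw = subst (TotPos D) (sym (⊕-identityˡ w)) tw

-- Representations of 4 β_j

-- Coordinates with respect to a basis (B , R) of ℤ², by Cramer's rule.
module Coordinates (B R : OK) (unimodular : det B R ≡ 1ℤ) where

  private
    b₁ = proj₁ B
    b₂ = proj₂ B
    r₁ = proj₁ R
    r₂ = proj₂ R

  coords : OK → ℤ × ℤ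
  coords (x , y) = (x * r₂ - y * r₁ , b₁ * y - b₂ * x)

  fromCoords : ℤ × ℤ → OK
  fromCoords (m , n) = m · B ⊕ n · R

  private
    times-det : ∀ z → z * det B R ≡ z
    times-det z = trans (cong (z *_) unimodular) (ℤₚ.*-identityʳ z)

  fromCoords-coords : ∀ z → fromCoords (coords z) ≡ z
  fromCoords-coords (x , y) = cong₂ _,_ (trans (e₁ x y b₁ b₂ r₁ r₂) (times-det x)) (trans (e₂ x y b₁ b₂ r₁ r₂) (times-det y))
    where
    e₁ : ∀ x y b₁ b₂ r₁ r₂ → (x * r₂ - y * r₁) * b₁ + (b₁ * y - b₂ * x) * r₁ ≡ x * (b₁ * r₂ - b₂ * r₁)
    e₁ = solve-∀
    e₂ : ∀ x y b₁ b₂ r₁ r₂ → (x * r₂ - y * r₁) * b₂ + (b₁ * y - b₂ * x) * r₂ ≡ y * (b₁ * r₂ - b₂ * r₁)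
    e₂ = solve-∀

  coords-fromCoords : ∀ p → coords (fromCoords p) ≡ p
  coords-fromCoords (m , n) = cong₂ _,_ (trans (e₁ m n b₁ b₂ r₁ r₂) (times-det m)) (trans (e₂ m n b₁ b₂ r₁ r₂) (times-det n))
    where
    e₁ : ∀ m n b₁ b₂ r₁ r₂ → (m * b₁ + n * r₁) * r₂ - (m * b₂ + n * r₂) * r₁ ≡ m * (b₁ * r₂ - b₂ * r₁)
    e₁ = solve-∀
    e₂ : ∀ m n b₁ b₂ r₁ r₂ → b₁ * (m * b₂ + n * r₂) - b₂ * (m * b₁ + n * r₁) ≡ n * (b₁ * r₂ - b₂ * r₁)
    e₂ = solve-∀

  coords-injective : ∀ {z w} → coords z ≡ coords w → z ≡ w
  coords-injective {z} {w} eq = trans (sym (fromCoords-coords z)) (trans (cong fromCoords eq) (fromCoords-coords w))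

  coords-⊕ : ∀ z w → coords (z ⊕ w) ≡ coords z ⊕ coords w
  coords-⊕ (x , y) (x′ , y′) = cong₂ _,_ (e x y x′ y′ r₂ r₁) (e′ x y x′ y′ b₁ b₂)
    where
    e : ∀ x y x′ y′ r₂ r₁ → (x + x′) * r₂ - (y + y′) * r₁ ≡ x * r₂ - y * r₁ + (x′ * r₂ - y′ * r₁)
    e = solve-∀
    e′ : ∀ x y x′ y′ b₁ b₂ → b₁ * (y + y′) - b₂ * (x + x′) ≡ b₁ * y - b₂ * x + (b₁ * y′ - b₂ * x′)
    e′ = solve-∀

  coords-· : ∀ n z → coords (n · z) ≡ n · coords z
  coords-· n (x , y) = cong₂ _,_ (e n x y r₂ r₁) (e′ n x y b₁ b₂)
    where
    e : ∀ n x y r₂ r₁ → n * x * r₂ - n * y * r₁ ≡ n * (x * r₂ - y * r₁)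
    e = solve-∀
    e′ : ∀ n x y b₁ b₂ → b₁ * (n * y) - b₂ * (n * x) ≡ n * (b₁ * y - b₂ * x)
    e′ = solve-∀

  coords-sumOK : ∀ zs → coords (sumOK zs) ≡ sumOK (map coords zs)
  coords-sumOK [] = cong₂ _,_ (e r₂ r₁) (e′ b₁ b₂)
    where
    e : ∀ r₂ r₁ → 0ℤ * r₂ - 0ℤ * r₁ ≡ 0ℤ
    e = solve-∀
    e′ : ∀ b₁ b₂ → b₁ * 0ℤ - b₂ * 0ℤ ≡ 0ℤ
    e′ = solve-∀
  coords-sumOK (z ∷ zs) = trans (coords-⊕ z (sumOK zs)) (cong (coords z ⊕_) (coords-sumOK zs))

  coords-B : coords B ≡ (1ℤ , 0ℤ)
  coords-B = cong₂ _,_ unimodular (e b₁ b₂)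
    where
    e : ∀ b₁ b₂ → b₁ * b₂ - b₂ * b₁ ≡ 0ℤ
    e = solve-∀

  coords-R : coords R ≡ (0ℤ , 1ℤ)
  coords-R = cong₂ _,_ (e r₁ r₂) unimodular
    where
    e : ∀ r₁ r₂ → r₁ * r₂ - r₂ * r₁ ≡ 0ℤ
    e = solve-∀

partitionsOf4 : Fin 5 → List⁺ ℕ
partitionsOf4 zero = 4 ∷ []
partitionsOf4 (suc zero) = 3 ∷ 1 ∷ []
partitionsOf4 (suc (suc zero)) = 2 ∷ 2 ∷ []
partitionsOf4 (suc (suc (suc zero))) = 2 ∷ 1 ∷ 1 ∷ []
partitionsOf4 (suc (suc (suc (suc zero)))) = 1 ∷ 1 ∷ 1 ∷ 1 ∷ []

private
  -- stated for the predecessors ms, so that the sum unfolds far enough for the coverage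
  -- checker to rule out every other shape of list
  partitionOf4⁺ : ∀ ms → sum (map suc ms) ≡ 4 → ∃ λ i → map suc ms ↭ toList (partitionsOf4 i)
  partitionOf4⁺ (3 ∷ []) refl = zero , ↭-refl
  partitionOf4⁺ (2 ∷ 0 ∷ []) refl = suc zero , ↭-refl
  partitionOf4⁺ (0 ∷ 2 ∷ []) refl = suc zero , swap 1 3 ↭-refl
  partitionOf4⁺ (1 ∷ 1 ∷ []) refl = suc (suc zero) , ↭-refl
  partitionOf4⁺ (1 ∷ 0 ∷ 0 ∷ []) refl = suc (suc (suc zero)) , ↭-refl
  partitionOf4⁺ (0 ∷ 1 ∷ 0 ∷ []) refl = suc (suc (suc zero)) , swap 1 2 ↭-refl
  partitionOf4⁺ (0 ∷ 0 ∷ 1 ∷ []) refl = suc (suc (suc zero)) , ↭-trans (prep 1 (swap 1 2 ↭-refl)) (swap 1 2 ↭-refl)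
  partitionOf4⁺ (0 ∷ 0 ∷ 0 ∷ 0 ∷ []) refl = suc (suc (suc (suc zero))) , ↭-refl

compositionOf4 : ∀ ns → All (1 ℕ.≤_) ns → sum ns ≡ 4 → ∃ λ i → ns ↭ toList (partitionsOf4 i)
compositionOf4 ns pos =
  subst (λ ns → sum ns ≡ 4 → ∃ λ i → ns ↭ toList (partitionsOf4 i)) (sucs-pred pos) (partitionOf4⁺ (map ℕ.pred ns))
  where
  sucs-pred : ∀ {ns} → All (1 ℕ.≤_) ns → map suc (map ℕ.pred ns) ≡ ns
  sucs-pred [] = refl
  sucs-pred (s≤s _ ∷ pos) = cong (_ ∷_) (sucs-pred pos)

gap-arith : ∀ {p q P Q} → 1 ℕ.≤ p → p ℕ.+ 2 ℕ.≤ q → 1 ℕ.≤ Q → p ℕ.+ P ≡ 4 → q ℕ.+ Q ≡ 4 →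
            p ≡ 1 × P ≡ 3 × q ≡ 3 × Q ≡ 1
gap-arith {p} {q} {P} {Q} 1≤p p+2≤q 1≤Q p+P≡4 q+Q≡4 =
  p≡1 , ℕₚ.+-cancelˡ-≡ 1 P 3 (subst (λ x → x ℕ.+ P ≡ 4) p≡1 p+P≡4) ,
  q≡3 , ℕₚ.+-cancelˡ-≡ 3 Q 1 (subst (λ x → x ℕ.+ Q ≡ 4) q≡3 q+Q≡4)
  where
  q≡3 : q ≡ 3
  q≡3 = ℕₚ.≤-antisym
    (ℕₚ.+-cancelʳ-≤ 1 q 3 (subst (q ℕ.+ 1 ℕ.≤_) q+Q≡4 (ℕₚ.+-monoʳ-≤ q 1≤Q)))
    (ℕₚ.≤-trans (ℕₚ.+-monoˡ-≤ 2 1≤p) p+2≤q)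
  p≡1 : p ≡ 1
  p≡1 = ℕₚ.≤-antisym (ℕₚ.+-cancelʳ-≤ 2 p 1 (subst (p ℕ.+ 2 ℕ.≤_) q≡3 p+2≤q)) 1≤p

extract : ∀ {A : Set} {P : A → Set} {xs} → Any P xs → ∃₂ λ x rest → P x × xs ↭ x ∷ rest
extract (here px) = _ , _ , px , ↭-refl
extract (there any) with extract any
... | x , rest , px , xs↭ = x , _ ∷ rest , px , ↭-trans (prep _ xs↭) (swap _ _ ↭-refl)

module _ {A : Set} (σ τ : A → ℕ) where

  PositiveWeights : A → Set
  PositiveWeights a = 1 ℕ.≤ σ a × 1 ℕ.≤ τ a

  Gapped : A → Set
  Gapped a = σ a ≡ τ a ⊎ σ a ℕ.+ 2 ℕ.≤ τ a ⊎ τ a ℕ.+ 2 ℕ.≤ σ a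

  private
    singleton : ∀ (f : A → ℕ) b rest → 1 ℕ.≤ f b → All (λ a → 1 ℕ.≤ f a) rest →
                f b ℕ.+ sum (map f rest) ≡ 1 → f b ≡ 1 × rest ≡ []
    singleton f b rest 1≤fb pos e = trans (sym (ℕₚ.+-identityʳ (f b))) (subst (λ S → f b ℕ.+ S ≡ 1) S≡0 e) , empty rest pos S≡0
      where
      S≡0 : sum (map f rest) ≡ 0
      S≡0 = ℕₚ.n≤0⇒n≡0 (ℕₚ.+-cancelˡ-≤ 1 _ 0 (subst (1 ℕ.+ sum (map f rest) ℕ.≤_) e (ℕₚ.+-monoˡ-≤ (sum (map f rest)) 1≤fb)))
      empty : ∀ xs → All (λ a → 1 ℕ.≤ f a) xs → sum (map f xs) ≡ 0 → xs ≡ []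
      empty [] _ _ = refl
      empty (x ∷ xs) (1≤fx ∷ _) e = contradiction (ℕₚ.m+n≡0⇒m≡0 (f x) e) (ℕₚ.n>0⇒n≢0 1≤fx)

    offDiagonal : ∀ a rest → σ a ≢ τ a → All PositiveWeights (a ∷ rest) → All Gapped (a ∷ rest) →
                  σ a ℕ.+ sum (map σ rest) ≡ 4 → τ a ℕ.+ sum (map τ rest) ≡ 4 →
                  ∃₂ λ c d → a ∷ rest ↭ c ∷ d ∷ [] × (σ c ≡ 1 × τ c ≡ 3) × (σ d ≡ 3 × τ d ≡ 1)
    offDiagonal a [] σa≢τa _ _ eσ eτ =
      contradiction (trans (sym (ℕₚ.+-identityʳ (σ a))) (trans eσ (trans (sym eτ) (ℕₚ.+-identityʳ (τ a))))) σa≢τa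
    offDiagonal a (b ∷ rest) σa≢τa ((1≤σa , 1≤τa) ∷ (1≤σb , 1≤τb) ∷ pos) (gap-a ∷ _) eσ eτ with gap-a
    ... | inj₁ σa≡τa = contradiction σa≡τa σa≢τa
    ... | inj₂ (inj₁ up) with gap-arith 1≤σa up (ℕₚ.≤-trans 1≤τb (ℕₚ.m≤m+n _ _)) eσ eτ
    ...   | σa≡1 , Σσ≡3 , τa≡3 , Στ≡1 with singleton τ b rest 1≤τb (All.map proj₂ pos) Στ≡1
    ...     | τb≡1 , refl = a , b , ↭-refl , (σa≡1 , τa≡3) , (trans (sym (ℕₚ.+-identityʳ (σ b))) Σσ≡3 , τb≡1)
    offDiagonal a (b ∷ rest) σa≢τa ((1≤σa , 1≤τa) ∷ (1≤σb , 1≤τb) ∷ pos) (gap-a ∷ _) eσ eτ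
      | inj₂ (inj₂ down) with gap-arith 1≤τa down (ℕₚ.≤-trans 1≤σb (ℕₚ.m≤m+n _ _)) eτ eσ
    ...   | τa≡1 , Στ≡3 , σa≡3 , Σσ≡1 with singleton σ b rest 1≤σb (All.map proj₁ pos) Σσ≡1
    ...     | σb≡1 , refl = b , a , swap a b ↭-refl , (σb≡1 , trans (sym (ℕₚ.+-identityʳ (τ b))) Στ≡3) , (σa≡3 , τa≡1)

  diagonal⊎pair : ∀ xs → All PositiveWeights xs → All Gapped xs → sum (map σ xs) ≡ 4 → sum (map τ xs) ≡ 4 →
              All (λ a → σ a ≡ τ a) xs ⊎
              ∃₂ λ c d → xs ↭ c ∷ d ∷ [] × (σ c ≡ 1 × τ c ≡ 3) × (σ d ≡ 3 × τ d ≡ 1)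
  diagonal⊎pair xs pos gap Σσ Στ with all? (λ a → σ a ℕ.≟ τ a) xs
  ... | yes diagonal = inj₁ diagonal
  ... | no ¬diagonal with extract (All.¬All⇒Any¬ (λ a → σ a ℕ.≟ τ a) xs ¬diagonal)
  ...   | a , rest , σa≢τa , xs↭ with offDiagonal a rest σa≢τa (All-resp-↭ xs↭ pos) (All-resp-↭ xs↭ gap) (moved σ Σσ) (moved τ Στ)
    where
    moved : ∀ f → sum (map f xs) ≡ 4 → f a ℕ.+ sum (map f rest) ≡ 4
    moved f Σf = trans (sym (sum-↭ (map⁺ f xs↭))) Σf
  ...     | c , d , a∷rest↭ , wc , wd = inj₂ (c , d , ↭-trans xs↭ a∷rest↭ , wc , wd)

-- For three consecutive indecomposables L, B, R with L + R = v B, a point (x , y) stands for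
-- x B + y R; sᴿ is its coefficient sum in the basis (B , R), sᴸ v the one in the basis (L , B).
sᴿ : ℤ × ℤ → ℤ
sᴿ (x , y) = x + y

sᴸ : ℕ → ℤ × ℤ → ℤ
sᴸ v (x , y) = x + (+ v - 1ℤ) * y

sᴿ-⊕ : ∀ p q → sᴿ (p ⊕ q) ≡ sᴿ p + sᴿ q
sᴿ-⊕ (x , y) (x′ , y′) = e x y x′ y′
  where
  e : ∀ x y x′ y′ → x + x′ + (y + y′) ≡ x + y + (x′ + y′)
  e = solve-∀

sᴸ-⊕ : ∀ v p q → sᴸ v (p ⊕ q) ≡ sᴸ v p + sᴸ v q
sᴸ-⊕ v (x , y) (x′ , y′) = e x y x′ y′ (+ v - 1ℤ)
  where
  e : ∀ x y x′ y′ u → x + x′ + u * (y + y′) ≡ x + u * y + (x′ + u * y′)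
  e = solve-∀

sᴸ-𝟘 : ∀ v → sᴸ v 𝟘 ≡ 0ℤ
sᴸ-𝟘 v = trans (ℤₚ.+-identityˡ _) (ℤₚ.*-zeroʳ (+ v - 1ℤ))

record Admissible (v : ℕ) (p : ℤ × ℤ) : Set where
  constructor _,_
  field
    sᴿ-pos : 0ℤ < sᴿ p
    sᴸ-pos : 0ℤ < sᴸ v p

onAxis : ℕ → ℤ × ℤ
onAxis n = (+ n , 0ℤ)

private
  sum-∣∣ : ∀ (f : ℤ × ℤ → ℤ) → (∀ p q → f (p ⊕ q) ≡ f p + f q) → f 𝟘 ≡ 0ℤ →
           ∀ ps → All (λ p → 0ℤ < f p) ps → + sum (map (λ p → ℤ.∣ f p ∣) ps) ≡ f (sumOK ps)
  sum-∣∣ f f-⊕ f-𝟘 [] [] = sym f-𝟘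
  sum-∣∣ f f-⊕ f-𝟘 (p ∷ ps) (0<fp ∷ pos) =
    trans (cong₂ _+_ (0<⇒+∣∣≡ 0<fp) (sum-∣∣ f f-⊕ f-𝟘 ps pos)) (sym (f-⊕ p (sumOK ps)))

  times-≡±2 : ∀ w y k → 2 ℕ.≤ w → ℤ.∣ k ∣ ≡ 1 → + w * y ≡ + 2 * k → w ≡ 2 × y ≡ k
  times-≡±2 w y k 2≤w ∣k∣≡1 e = w≡2 , ℤₚ.*-cancelˡ-≡ (+ 2) y k (subst (λ u → + u * y ≡ + 2 * k) w≡2 e)
    where
    open ≡-Reasoning
    w≡2 : w ≡ 2
    w≡2 = ℕₚ.≤-antisym (∣⇒≤ (divides ℤ.∣ y ∣ (begin
      2                  ≡⟨ cong (2 ℕ.*_) (sym ∣k∣≡1) ⟩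
      2 ℕ.* ℤ.∣ k ∣      ≡⟨ sym (ℤₚ.abs-* (+ 2) k) ⟩
      ℤ.∣ + 2 * k ∣      ≡⟨ cong ℤ.∣_∣ (sym e) ⟩
      ℤ.∣ + w * y ∣      ≡⟨ ℤₚ.abs-* (+ w) y ⟩
      w ℕ.* ℤ.∣ y ∣      ≡⟨ ℕₚ.*-comm w ℤ.∣ y ∣ ⟩
      ℤ.∣ y ∣ ℕ.* w      ∎))) 2≤w

module _ {v : ℕ} (4≤v : 4 ℕ.≤ v) where

  private
    w = v ℕ.∸ 2
    2≤v : 2 ℕ.≤ v
    2≤v = ℕₚ.≤-trans (s≤s (s≤s z≤n)) 4≤v
    2≤w : 2 ℕ.≤ w
    2≤w = ℕₚ.∸-monoˡ-≤ 2 4≤v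

    σ τ : ℤ × ℤ → ℕ
    σ p = ℤ.∣ sᴿ p ∣
    τ p = ℤ.∣ sᴸ v p ∣

    weights≥1 : ∀ {p} → Admissible v p → PositiveWeights σ τ p
    weights≥1 (0<s , 0<t) = 0<⇒1≤∣∣ 0<s , 0<⇒1≤∣∣ 0<t

    weights : ∀ p → Admissible v p → proj₁ p ≡ + σ p - proj₂ p × + w * proj₂ p ≡ + τ p - + σ p
    weights (x , y) (0<s , 0<t) = trans (e₁ x y) (cong (_- y) (sym (0<⇒+∣∣≡ 0<s))) ,
      trans (cong (_* y) +w) (trans (e₂ x y (+ v)) (sym (cong₂ _-_ (0<⇒+∣∣≡ 0<t) (0<⇒+∣∣≡ 0<s))))
      where
      +w : + w ≡ + v - + 2
      +w = pos-∸ 2≤v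
      e₁ : ∀ x y → x ≡ x + y - y
      e₁ = solve-∀
      e₂ : ∀ x y v → (v - + 2) * y ≡ x + (v - 1ℤ) * y - (x + y)
      e₂ = solve-∀

    gapped : ∀ {p} → Admissible v p → Gapped σ τ p
    gapped {p} adm = gap (proj₂ p) (proj₂ (weights p adm))
      where
      ahead : ∀ {a b} m → + w * + m ≡ + b - + a → b ≡ a ℕ.+ w ℕ.* m
      ahead {a} {b} m e = ℤₚ.+-injective (trans (e′ (+ b) (+ a)) (cong (_+_ (+ a)) (trans (sym e) (sym (ℤₚ.pos-* w m)))))
        where
        e′ : ∀ b a → b ≡ a + (b - a)
        e′ = solve-∀
      apart : ∀ a k → a ℕ.+ 2 ℕ.≤ a ℕ.+ w ℕ.* suc k
      apart a k = ℕₚ.+-monoʳ-≤ a (ℕₚ.≤-trans 2≤w (ℕₚ.m≤m*n w (suc k)))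
      gap : ∀ {a b} y → + w * y ≡ + b - + a → a ≡ b ⊎ a ℕ.+ 2 ℕ.≤ b ⊎ b ℕ.+ 2 ℕ.≤ a
      gap {a} {b} (+ zero) e = inj₁ (sym (ℤₚ.+-injective (ℤₚ.i-j≡0⇒i≡j (+ b) (+ a) (trans (sym e) (ℤₚ.*-zeroʳ (+ w))))))
      gap {a} {b} (+ suc k) e = inj₂ (inj₁ (subst (a ℕ.+ 2 ℕ.≤_) (sym (ahead (suc k) e)) (apart a k)))
      gap {a} {b} -[1+ k ] e = inj₂ (inj₂ (subst (b ℕ.+ 2 ℕ.≤_) (sym (ahead (suc k) e′)) (apart b k)))
        where
        e′ : + w * + suc k ≡ + a - + b
        e′ = trans (sym (ℤₚ.neg-distribʳ-* (+ w) -[1+ k ])) (trans (cong -_ e) (n (+ b) (+ a)))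
          where
          n : ∀ b a → - (b - a) ≡ a - b
          n = solve-∀

    on-axis : ∀ {p} → Admissible v p → σ p ≡ τ p → onAxis (σ p) ≡ p
    on-axis {x , y} adm σ≡τ = sym (cong₂ _,_ (trans x≡ (trans (cong (_-_ (+ σ (x , y))) y≡0) (ℤₚ.+-identityʳ _))) y≡0)
      where
      x≡ = proj₁ (weights (x , y) adm)
      y≡0 : y ≡ 0ℤ
      wy≡0 : + w * y ≡ 0ℤ
      wy≡0 = trans (proj₂ (weights (x , y) adm)) (trans (cong (λ n → + n - + σ (x , y)) (sym σ≡τ)) (ℤₚ.+-inverseʳ (+ σ (x , y))))
      y≡0 with ℤₚ.i*j≡0⇒i≡0∨j≡0 (+ w) wy≡0
      ... | inj₁ w≡0 = ⊥-elim (ℕₚ.<⇒≢ (ℕₚ.≤-trans (s≤s z≤n) 2≤w) (sym (ℤₚ.+-injective w≡0)))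
      ... | inj₂ y≡0 = y≡0

    off-axis : ∀ p a b k → Admissible v p → σ p ≡ a → τ p ≡ b → ℤ.∣ k ∣ ≡ 1 → + b - + a ≡ + 2 * k →
            w ≡ 2 × p ≡ (+ a - k , k)
    off-axis (x , y) a b k adm refl refl ∣k∣≡1 e with times-≡±2 w y k 2≤w ∣k∣≡1 (trans (proj₂ (weights (x , y) adm)) e)
    ... | w≡2 , refl = w≡2 , cong (_, y) (proj₁ (weights (x , y) adm))

    Σσ≡4 : ∀ {ps} → All (Admissible v) ps → sumOK ps ≡ (+ 4 , 0ℤ) → sum (map σ ps) ≡ 4
    Σσ≡4 {ps} adm Σps = ℤₚ.+-injective
      (trans (sum-∣∣ sᴿ sᴿ-⊕ refl ps (All.map Admissible.sᴿ-pos adm)) (cong sᴿ Σps))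

    Στ≡4 : ∀ {ps} → All (Admissible v) ps → sumOK ps ≡ (+ 4 , 0ℤ) → sum (map τ ps) ≡ 4
    Στ≡4 {ps} adm Σps = ℤₚ.+-injective
      (trans (sum-∣∣ (sᴸ v) (sᴸ-⊕ v) (sᴸ-𝟘 v) ps (All.map Admissible.sᴸ-pos adm))
             (trans (cong (sᴸ v) Σps) (cong (_+_ (+ 4)) (ℤₚ.*-zeroʳ (+ v - 1ℤ)))))

  classifyPoints : ∀ ps → All (Admissible v) ps → sumOK ps ≡ (+ 4 , 0ℤ) →
                   (∃ λ i → ps ↭ map onAxis (toList (partitionsOf4 i))) ⊎
                   (v ≡ 4 × ps ↭ (0ℤ , 1ℤ) ∷ (+ 4 , -1ℤ) ∷ [])
  classifyPoints ps adm Σps with diagonal⊎pair σ τ ps (All.map weights≥1 adm) (All.map gapped adm) (Σσ≡4 adm Σps) (Στ≡4 adm Σps)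
  ... | inj₁ diagonal with compositionOf4 (map σ ps) (All.map⁺ (All.map (λ a → proj₁ (weights≥1 a)) adm)) (Σσ≡4 adm Σps)
  ...   | i , σs↭ = inj₁ (i , subst (_↭ map onAxis (toList (partitionsOf4 i))) onAxis-σ (map⁺ onAxis σs↭))
    where
    onAxis-σ : map onAxis (map σ ps) ≡ ps
    onAxis-σ = trans (sym (map-∘ ps)) (map-id-local (All.zipWith (λ (a , d) → on-axis a d) (adm , diagonal)))
  classifyPoints ps adm Σps | inj₂ (c , d , ps↭ , (σc≡1 , τc≡3) , (σd≡3 , τd≡1)) with All-resp-↭ ps↭ adm
  ... | adm-c ∷ adm-d ∷ [] with off-axis c 1 3 1ℤ adm-c σc≡1 τc≡3 refl refl | off-axis d 3 1 -1ℤ adm-d σd≡3 τd≡1 refl refl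
  ...   | w≡2 , refl | _ , refl = inj₂ (trans (sym (ℕₚ.m∸n+n≡m 2≤v)) (cong (ℕ._+ 2) w≡2) , ps↭)

-- The properties of three consecutive indecomposables β_{j-1}, β_j, β_{j+1} (with v = v_j)
-- that the count uses.
record Consecutive (D v : ℕ) (L B R : OK) : Set where
  field
    L⁺ : TotPos D L
    B⁺ : TotPos D B
    R⁺ : TotPos D R
    L⊕R : L ⊕ R ≡ scale v B
    det≡1 : det B R ≡ 1ℤ
    R⊖B : Mixed D (R ⊖ B)
    B⊖L : Mixed D (B ⊖ L)

Consecutive-conj : ∀ {D v L B R} → Consecutive D v L B R → Consecutive D v (conj D R) (conj D B) (conj D L)
Consecutive-conj {D} {v} {L} {B} {R} T = record
  { L⁺ = TotPos-conj D R R⁺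
  ; B⁺ = TotPos-conj D B B⁺
  ; R⁺ = TotPos-conj D L L⁺
  ; L⊕R = trans (sym (conj-⊕ D R L)) (trans (cong (conj D) (trans (⊕-comm R L) L⊕R)) (conj-· D (+ v) B))
  ; det≡1 = trans (det-conj D B L) (trans (det-left {v} {L} {B} {R} L⊕R) det≡1)
  ; R⊖B = Mixed-conj D L B B⊖L
  ; B⊖L = Mixed-conj D B R R⊖B
  }
  where open Consecutive T

-- (a , b , c) stands for a L + b B + c R, whose coordinates are (a v + b , c - a).
Cone : Set
Cone = ℕ × ℕ × ℕ

coneCoords : ℕ → Cone → ℤ × ℤ
coneCoords v (a , b , c) = (+ (a ℕ.* v ℕ.+ b) , + c - + a)

NonZeroCone : Cone → Set
NonZeroCone (a , b , c) = 1 ℕ.≤ a ℕ.+ b ℕ.+ c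

-- Σ 5 ^ k over a list of exponents k is invariant under permutations; that it separates the
-- finitely many candidate representations below is checked by evaluation.
code : ℤ × ℤ → ℕ
code (x , y) = 5 ℕ.^ (ℤ.∣ x ∣ ℕ.+ 5 ℕ.* ℤ.∣ y + + 2 ∣)

fingerprint : List (ℤ × ℤ) → ℕ
fingerprint ps = sum (map code ps)

fingerprint-↭ : ∀ {ps qs} → ps ↭ qs → fingerprint ps ≡ fingerprint qs
fingerprint-↭ p = sum-↭ (map⁺ code p)

module _ (v : ℕ) {n : ℕ} (cs : Fin n → List⁺ Cone) where

  conesCoords : Fin n → List (ℤ × ℤ)
  conesCoords i = map (coneCoords v) (toList (cs i))

  ValidCandidates : Set
  ValidCandidates = (∀ i → All NonZeroCone (toList (cs i))) ×
          (∀ i → sumOK (conesCoords i) ≡ (+ 4 , 0ℤ)) ×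
          (∀ i j → fingerprint (conesCoords i) ≡ fingerprint (conesCoords j) → i ≡ j)

  Complete : Set
  Complete = ∀ ps → All (Admissible v) ps → sumOK ps ≡ (+ 4 , 0ℤ) → ∃ λ i → ps ↭ conesCoords i

  validCandidates? : Dec ValidCandidates
  validCandidates? =
          Finₚ.all? (λ i → All.all? (λ (a , b , c) → 1 ℕ.≤? a ℕ.+ b ℕ.+ c) (toList (cs i)))
    ×-dec Finₚ.all? (λ i → Productₚ.≡-dec ℤ._≟_ ℤ._≟_ (sumOK (conesCoords i)) (+ 4 , 0ℤ))
    ×-dec Finₚ.all? (λ i → Finₚ.all? λ j → (fingerprint (conesCoords i) ℕ.≟ fingerprint (conesCoords j)) →-dec (i Fin.≟ j))

module Counting {D v : ℕ} {L B R : OK} (T : Consecutive D v L B R) where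

  open Consecutive T
  open Coordinates B R det≡1

  coords-L : coords L ≡ (+ v , -1ℤ)
  coords-L = begin
    coords L                            ≡⟨ sym (⊕-⊖ (coords L) (coords R)) ⟩
    (coords L ⊕ coords R) ⊖ coords R    ≡⟨ cong (_⊖ coords R) (sym (coords-⊕ L R)) ⟩
    coords (L ⊕ R) ⊖ coords R           ≡⟨ cong₂ _⊖_ (cong coords L⊕R) coords-R ⟩
    coords ((+ v) · B) ⊖ (0ℤ , 1ℤ)      ≡⟨ cong (_⊖ (0ℤ , 1ℤ)) (trans (coords-· (+ v) B) (cong ((+ v) ·_) coords-B)) ⟩
    (+ v) · (1ℤ , 0ℤ) ⊖ (0ℤ , 1ℤ)       ≡⟨ cong₂ _,_ (e₁ (+ v)) (e₂ (+ v)) ⟩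
    (+ v , -1ℤ)                         ∎
    where
    open ≡-Reasoning
    e₁ : ∀ v → v * 1ℤ - 0ℤ ≡ v
    e₁ = solve-∀
    e₂ : ∀ v → v * 0ℤ - 1ℤ ≡ -1ℤ
    e₂ = solve-∀

  admissible : ∀ l → TotPos D l → Admissible v (coords l)
  admissible l tl =
    coeffSum-pos D B R {x} {y} B⁺ R⊖B (subst (TotPos D) (sym (fromCoords-coords l)) tl) ,
    subst (0ℤ <_) (e x y (+ v)) (coeffSum-pos D L B {(- y)} {x + + v * y} L⁺ B⊖L (subst (TotPos D) l≡ tl))
    where
    x = proj₁ (coords l)
    y = proj₂ (coords l)
    e : ∀ x y v → - y + (x + v * y) ≡ x + (v - 1ℤ) * y
    e = solve-∀
    l≡ : l ≡ (- y) · L ⊕ (x + + v * y) · B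
    l≡ = coords-injective (begin
      coords l                                                ≡⟨ cong₂ _,_ (e₁ x y (+ v)) (e₂ x y (+ v)) ⟩
      (- y) · (+ v , -1ℤ) ⊕ (x + + v * y) · (1ℤ , 0ℤ)         ≡⟨ sym (cong₂ (λ p q → (- y) · p ⊕ (x + + v * y) · q) coords-L coords-B) ⟩
      (- y) · coords L ⊕ (x + + v * y) · coords B             ≡⟨ sym (cong₂ _⊕_ (coords-· (- y) L) (coords-· (x + + v * y) B)) ⟩
      coords ((- y) · L) ⊕ coords ((x + + v * y) · B)         ≡⟨ sym (coords-⊕ _ _) ⟩
      coords ((- y) · L ⊕ (x + + v * y) · B)                  ∎)
      where
      open ≡-Reasoning
      e₁ : ∀ x y v → x ≡ - y * v + (x + v * y) * 1ℤ
      e₁ = solve-∀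
      e₂ : ∀ x y v → y ≡ - y * -1ℤ + (x + v * y) * 0ℤ
      e₂ = solve-∀

  coords-4B : coords (scale 4 B) ≡ (+ 4 , 0ℤ)
  coords-4B = trans (coords-· (+ 4) B) (cong ((+ 4) ·_) coords-B)

  ⟦_⟧ : Cone → OK
  ⟦ k ⟧ = fromCoords (coneCoords v k)

  coords-⟦⟧ : ∀ ks → map coords (map ⟦_⟧ ks) ≡ map (coneCoords v) ks
  coords-⟦⟧ ks = trans (sym (map-∘ ks)) (map-cong (λ k → coords-fromCoords (coneCoords v k)) ks)

  ⟦⟧-≡ : ∀ a b c → ⟦ a , b , c ⟧ ≡ (+ a) · L ⊕ ((+ b) · B ⊕ (+ c) · R)
  ⟦⟧-≡ a b c = coords-injective (begin
    coords ⟦ a , b , c ⟧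
      ≡⟨ coords-fromCoords (coneCoords v (a , b , c)) ⟩
    (+ (a ℕ.* v ℕ.+ b) , + c - + a)
      ≡⟨ cong₂ _,_ (trans (cong (_+ + b) (ℤₚ.pos-* a v)) (e₁ (+ a) (+ v) (+ b) (+ c))) (e₂ (+ a) (+ v) (+ b) (+ c)) ⟩
    (+ a) · (+ v , -1ℤ) ⊕ ((+ b) · (1ℤ , 0ℤ) ⊕ (+ c) · (0ℤ , 1ℤ))
      ≡⟨ sym (cong₂ _⊕_ (cong ((+ a) ·_) coords-L) (cong₂ _⊕_ (cong ((+ b) ·_) coords-B) (cong ((+ c) ·_) coords-R))) ⟩
    (+ a) · coords L ⊕ ((+ b) · coords B ⊕ (+ c) · coords R)
      ≡⟨ sym (cong₂ _⊕_ (coords-· (+ a) L) (cong₂ _⊕_ (coords-· (+ b) B) (coords-· (+ c) R))) ⟩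
    coords ((+ a) · L) ⊕ (coords ((+ b) · B) ⊕ coords ((+ c) · R))
      ≡⟨ sym (trans (coords-⊕ _ _) (cong (coords ((+ a) · L) ⊕_) (coords-⊕ _ _))) ⟩
    coords ((+ a) · L ⊕ ((+ b) · B ⊕ (+ c) · R)) ∎)
    where
    open ≡-Reasoning
    e₁ : ∀ a v b c → a * v + b ≡ a * v + (b * 1ℤ + c * 0ℤ)
    e₁ = solve-∀
    e₂ : ∀ a v b c → c - a ≡ a * -1ℤ + (b * 0ℤ + c * 1ℤ)
    e₂ = solve-∀

  ⟦⟧-TotPos : ∀ k → NonZeroCone k → TotPos D ⟦ k ⟧
  ⟦⟧-TotPos (a , b , c) nz = subst (TotPos D) (sym (⟦⟧-≡ a b c)) (combination a b c nz)
    where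
    0<suc : ∀ n → 0ℤ < + suc n
    0<suc n = +<+ (s≤s z≤n)
    combination : ∀ a b c → NonZeroCone (a , b , c) → TotPos D ((+ a) · L ⊕ ((+ b) · B ⊕ (+ c) · R))
    combination (suc a) b c _ = TotPos-⊕ʳ D ((+ suc a) · L) _ (TotPos-· D L (0<suc a) L⁺)
      (TotNonNeg-⊕ D ((+ b) · B) _ (TotNonNeg-· D b B B⁺) (TotNonNeg-· D c R R⁺))
    combination zero (suc b) c _ = TotPos-⊕ˡ D (0ℤ · L) _ (TotNonNeg-· D 0 L L⁺)
      (TotPos-⊕ʳ D ((+ suc b) · B) _ (TotPos-· D B (0<suc b) B⁺) (TotNonNeg-· D c R R⁺))
    combination zero zero (suc c) _ = TotPos-⊕ˡ D (0ℤ · L) _ (TotNonNeg-· D 0 L L⁺)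
      (TotPos-⊕ˡ D (0ℤ · B) _ (TotNonNeg-· D 0 B B⁺) (TotPos-· D R (0<suc c) R⁺))

  represent : (ks : List⁺ Cone) → All NonZeroCone (toList ks) →
              sumOK (map (coneCoords v) (toList ks)) ≡ (+ 4 , 0ℤ) → Rep D (scale 4 B)
  represent ks nonZero Σks =
    map ⟦_⟧ (toList ks) , (λ ()) , All.map⁺ (All.map (λ {k} → ⟦⟧-TotPos k) nonZero) ,
    coords-injective (begin
      coords (sumOK (map ⟦_⟧ (toList ks)))        ≡⟨ coords-sumOK (map ⟦_⟧ (toList ks)) ⟩
      sumOK (map coords (map ⟦_⟧ (toList ks)))    ≡⟨ cong sumOK (coords-⟦⟧ (toList ks)) ⟩
      sumOK (map (coneCoords v) (toList ks))      ≡⟨ trans Σks (sym coords-4B) ⟩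
      coords (scale 4 B)                          ∎)
    where open ≡-Reasoning

  atLeast : ∀ {n} (cs : Fin n → List⁺ Cone) → ValidCandidates v cs → PartAtLeast D (scale 4 B) n
  atLeast cs (nonZero , Σcs , separated) = (λ i → represent (cs i) (nonZero i) (Σcs i)) ,
    λ i j p → separated i j (fingerprint-↭ (subst₂ _↭_ (coords-⟦⟧ (toList (cs i))) (coords-⟦⟧ (toList (cs j))) (map⁺ coords p)))

  exactly : ∀ {n} (cs : Fin n → List⁺ Cone) → ValidCandidates v cs → Complete v cs →
            PartCount D (scale 4 B) n
  exactly cs valid complete = proj₁ (atLeast cs valid) , proj₂ (atLeast cs valid) , covered
    where
    coords-inverse : ∀ ls → map fromCoords (map coords ls) ≡ ls
    coords-inverse ls = trans (sym (map-∘ ls)) (trans (map-cong fromCoords-coords ls) (map-id ls))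
    covered : (ρ : Rep D (scale 4 B)) → ∃ λ i → proj₁ ρ ↭ map ⟦_⟧ (toList (cs i))
    covered (ls , _ , ls⁺ , Σls) =
      let i , ↭cs = complete (map coords ls) (All.map⁺ (All.map (λ {l} → admissible l) ls⁺))
                             (trans (sym (coords-sumOK ls)) (trans (cong coords Σls) coords-4B))
      in i , ↭-trans (↭-reflexive (sym (coords-inverse ls)))
                     (↭-trans (map⁺ fromCoords ↭cs) (↭-reflexive (sym (map-∘ (toList (cs i))))))

partitionCones : Fin 5 → List⁺ Cone
partitionCones i = List⁺.map (λ n → (0 , n , 0)) (partitionsOf4 i)

representations₄ : Fin 6 → List⁺ Cone
representations₄ zero = (0 , 0 , 1) ∷ (1 , 0 , 0) ∷ []
representations₄ (suc i) = partitionCones i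

representations₃ : Fin 8 → List⁺ Cone
representations₃ zero = (1 , 0 , 0) ∷ (0 , 0 , 1) ∷ (0 , 1 , 0) ∷ []
representations₃ (suc zero) = (1 , 1 , 0) ∷ (0 , 0 , 1) ∷ []
representations₃ (suc (suc zero)) = (1 , 0 , 0) ∷ (0 , 1 , 1) ∷ []
representations₃ (suc (suc (suc i))) = partitionCones i

representations₂ : Fin 16 → List⁺ Cone
representations₂ zero = (1 , 0 , 0) ∷ (0 , 0 , 1) ∷ (0 , 2 , 0) ∷ []
representations₂ (suc zero) = (1 , 0 , 0) ∷ (0 , 0 , 1) ∷ (0 , 1 , 0) ∷ (0 , 1 , 0) ∷ []
representations₂ (suc (suc zero)) = (1 , 0 , 0) ∷ (1 , 0 , 0) ∷ (0 , 0 , 1) ∷ (0 , 0 , 1) ∷ []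
representations₂ (suc (suc (suc zero))) = (2 , 0 , 0) ∷ (0 , 0 , 2) ∷ []
representations₂ (suc (suc (suc (suc zero)))) = (2 , 0 , 0) ∷ (0 , 0 , 1) ∷ (0 , 0 , 1) ∷ []
representations₂ (suc (suc (suc (suc (suc zero))))) = (1 , 0 , 0) ∷ (1 , 0 , 0) ∷ (0 , 0 , 2) ∷ []
representations₂ (suc (suc (suc (suc (suc (suc zero)))))) = (1 , 1 , 0) ∷ (0 , 1 , 1) ∷ []
representations₂ (suc (suc (suc (suc (suc (suc (suc zero))))))) = (1 , 1 , 0) ∷ (0 , 0 , 1) ∷ (0 , 1 , 0) ∷ []
representations₂ (suc (suc (suc (suc (suc (suc (suc (suc zero)))))))) = (0 , 1 , 1) ∷ (1 , 0 , 0) ∷ (0 , 1 , 0) ∷ []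
representations₂ (suc (suc (suc (suc (suc (suc (suc (suc (suc zero))))))))) = (0 , 2 , 1) ∷ (1 , 0 , 0) ∷ []
representations₂ (suc (suc (suc (suc (suc (suc (suc (suc (suc (suc zero)))))))))) = (1 , 2 , 0) ∷ (0 , 0 , 1) ∷ []
representations₂ (suc (suc (suc (suc (suc (suc (suc (suc (suc (suc (suc i))))))))))) = partitionCones i

module _ {D : ℕ} {L B R : OK} where

  partCount≥5 : ∀ {v} → Consecutive D v L B R → 5 ℕ.≤ v → PartCount D (scale 4 B) 5
  partCount≥5 {v} T 5≤v = Counting.exactly T partitionCones (from-yes (validCandidates? v partitionCones)) complete
    where
    complete : Complete v partitionCones
    complete ps adm Σps with classifyPoints (ℕₚ.≤-trans (ℕₚ.n≤1+n 4) 5≤v) ps adm Σps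
    ... | inj₁ (i , ps↭) = i , subst (ps ↭_) (map-∘ (toList (partitionsOf4 i))) ps↭
    ... | inj₂ (refl , _) = ⊥-elim (ℕₚ.<-irrefl refl 5≤v)

  partCount₄ : Consecutive D 4 L B R → PartCount D (scale 4 B) 6
  partCount₄ T = Counting.exactly T representations₄ (from-yes (validCandidates? 4 representations₄)) complete
    where
    complete : Complete 4 representations₄
    complete ps adm Σps with classifyPoints ℕₚ.≤-refl ps adm Σps
    ... | inj₁ (i , ps↭) = suc i , subst (ps ↭_) (map-∘ (toList (partitionsOf4 i))) ps↭
    ... | inj₂ (_ , ps↭) = zero , ps↭

  partAtLeast₃ : Consecutive D 3 L B R → PartAtLeast D (scale 4 B) 8
  partAtLeast₃ T = Counting.atLeast T representations₃ (from-yes (validCandidates? 3 representations₃))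

  partAtLeast₂ : Consecutive D 2 L B R → PartAtLeast D (scale 4 B) 16
  partAtLeast₂ T = Counting.atLeast T representations₂ (from-yes (validCandidates? 2 representations₂))

-- The continued fraction of ω_D

isqrtFrom-sound : ∀ n k → isqrtFrom n k ℕ.* isqrtFrom n k ℕ.≤ n
isqrtFrom-sound n zero = z≤n
isqrtFrom-sound n (suc k) with (suc k ℕ.* suc k) ℕ.≤ᵇ n in eq
... | true = ℕₚ.≤ᵇ⇒≤ (suc k ℕ.* suc k) n (subst T (sym eq) _)
... | false = isqrtFrom-sound n k

isqrtFrom-maximal : ∀ n k m → m ℕ.≤ k → m ℕ.* m ℕ.≤ n → m ℕ.≤ isqrtFrom n k
isqrtFrom-maximal n zero m m≤0 _ = m≤0
isqrtFrom-maximal n (suc k) m m≤k+1 m²≤n with (suc k ℕ.* suc k) ℕ.≤ᵇ n in eq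
... | true = m≤k+1
... | false with ℕₚ.m≤n⇒m<n∨m≡n m≤k+1
...   | inj₁ m<k+1 = isqrtFrom-maximal n k m (ℕₚ.≤-pred m<k+1) m²≤n
...   | inj₂ refl = ⊥-elim (subst T eq (ℕₚ.≤⇒≤ᵇ m²≤n))

<[isqrt+1]² : ∀ n → n ℕ.< suc (isqrt n) ℕ.* suc (isqrt n)
<[isqrt+1]² n = ℕₚ.≰⇒> λ sq≤n → ℕₚ.<-irrefl refl
  (isqrtFrom-maximal n n (suc (isqrt n)) (ℕₚ.≤-trans (ℕₚ.m≤m*n (suc (isqrt n)) (suc (isqrt n))) sq≤n) sq≤n)

module _ {D : ℕ} (2≤D : 2 ℕ.≤ D) (squareFree : SquareFree D) where

  isqrt²<D : isqrt D ℕ.* isqrt D ℕ.< D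
  isqrt²<D with ℕₚ.m≤n⇒m<n∨m≡n (isqrtFrom-sound D D)
  ... | inj₁ s²<D = s²<D
  ... | inj₂ s²≡D = contradiction (subst (2 ℕ.≤_) (trans (sym s²≡D) (cong (λ u → u ℕ.* u) s≡1)) 2≤D) λ { (s≤s ()) }
    where
    s≡1 : isqrt D ≡ 1
    s≡1 = squareFree (isqrt D) (divides 1 (trans (sym s²≡D) (sym (ℕₚ.*-identityˡ _))))

  1≤isqrt : 1 ℕ.≤ isqrt D
  1≤isqrt with isqrt D in eq
  ... | suc _ = s≤s z≤n
  ... | zero = contradiction (ℕₚ.≤-<-trans 2≤D (subst (λ s → D ℕ.< suc s ℕ.* suc s) eq (<[isqrt+1]² D))) λ { (s≤s ()) }

divℕ-≡ : ∀ n Q .{{_ : ℕ.NonZero Q}} → divℕ n Q ≡ n / Q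
divℕ-≡ n (suc q) = refl

-- One step of the continued fraction algorithm on a complete quotient (P + √D) / Q.
module ReductionStep (D : ℕ) (isqrt²<D : isqrt D ℕ.* isqrt D ℕ.< D) where

  private
    s = isqrt D

  record Reduced (P Q c : ℕ) : Set where
    field
      1≤Q : 1 ℕ.≤ Q
      P≤s : P ℕ.≤ s
      Q≤P+s : Q ℕ.≤ P ℕ.+ s
      norm : Q ℕ.* c ℕ.+ P ℕ.* P ≡ D

  quotient nextP nextQ : ℕ → ℕ → ℕ
  quotient P Q = divℕ (P ℕ.+ s) Q
  nextP P Q = quotient P Q ℕ.* Q ∸ P
  nextQ P Q = divℕ (D ∸ nextP P Q ℕ.* nextP P Q) Q

  module _ {P Q c : ℕ} (red : Reduced P Q c) where

    open Reduced red
    private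
      instance
        Q≢0 : ℕ.NonZero Q
        Q≢0 = ℕ.>-nonZero 1≤Q
      a = quotient P Q
      P′ = nextP P Q

      a≡ : a ≡ (P ℕ.+ s) / Q
      a≡ = divℕ-≡ (P ℕ.+ s) Q

      aQ≤P+s : a ℕ.* Q ℕ.≤ P ℕ.+ s
      aQ≤P+s = subst (λ a → a ℕ.* Q ℕ.≤ P ℕ.+ s) (sym a≡) (ℕ.m/n*n≤m (P ℕ.+ s) Q)

      P+s<aQ+Q : P ℕ.+ s ℕ.< a ℕ.* Q ℕ.+ Q
      P+s<aQ+Q = subst₂ ℕ._<_ (sym (trans (ℕ.m≡m%n+[m/n]*n (P ℕ.+ s) Q) (ℕₚ.+-comm ((P ℕ.+ s) % Q) ((P ℕ.+ s) / Q ℕ.* Q))))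
        (cong (λ a → a ℕ.* Q ℕ.+ Q) (sym a≡)) (ℕₚ.+-monoʳ-< ((P ℕ.+ s) / Q ℕ.* Q) (ℕ.m%n<n (P ℕ.+ s) Q))

    1≤quotient : 1 ℕ.≤ a
    1≤quotient = ℕₚ.n≢0⇒n>0 λ a≡0 → ℕₚ.<-irrefl refl
      (ℕₚ.<-≤-trans (subst (λ a → P ℕ.+ s ℕ.< a ℕ.* Q ℕ.+ Q) a≡0 P+s<aQ+Q) Q≤P+s)

    private
      -- if a Q ≤ P then s < Q ≤ a Q ≤ P ≤ s
      P<aQ : P ℕ.< a ℕ.* Q
      P<aQ = ℕₚ.≰⇒> λ aQ≤P → ℕₚ.<-irrefl refl (ℕₚ.≤-<-trans
        (ℕₚ.≤-trans (ℕₚ.≤-trans (ℕₚ.m≤n*m Q a {{ℕ.>-nonZero 1≤quotient}}) aQ≤P) P≤s)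
        (ℕₚ.+-cancelˡ-< P s Q (ℕₚ.<-≤-trans P+s<aQ+Q (ℕₚ.+-monoˡ-≤ Q aQ≤P))))

    P+nextP≡quotient*Q : P ℕ.+ P′ ≡ a ℕ.* Q
    P+nextP≡quotient*Q = ℕₚ.m+[n∸m]≡n (ℕₚ.<⇒≤ P<aQ)

    private
      P′≤s : P′ ℕ.≤ s
      P′≤s = ℕₚ.+-cancelˡ-≤ P P′ s (subst (ℕ._≤ P ℕ.+ s) (sym P+nextP≡quotient*Q) aQ≤P+s)

      P′²≤D : P′ ℕ.* P′ ℕ.≤ D
      P′²≤D = ℕₚ.≤-trans (ℕₚ.*-mono-≤ P′≤s P′≤s) (ℕₚ.<⇒≤ isqrt²<D)

      X : ℤ
      X = + c + + 2 * + a * + P - + a * + a * + Q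

      QX≡D-P′² : + Q * X ≡ + (D ∸ P′ ℕ.* P′)
      QX≡D-P′² = begin
        + Q * X                                     ≡⟨ e (+ Q) (+ c) (+ a) (+ P) ⟩
        + Q * + c + + P * + P - (+ a * + Q - + P) * (+ a * + Q - + P)
          ≡⟨ cong₂ (λ d p → d - p * p) (trans (cong₂ _+_ (sym (ℤₚ.pos-* Q c)) (sym (ℤₚ.pos-* P P))) (cong +_ norm))
                   (sym (trans (pos-∸ (ℕₚ.<⇒≤ P<aQ)) (cong (_- + P) (ℤₚ.pos-* a Q)))) ⟩
        + D - + P′ * + P′                           ≡⟨ cong (_-_ (+ D)) (ℤₚ.pos-* P′ P′) ⟨
        + D - + (P′ ℕ.* P′)                         ≡⟨ pos-∸ P′²≤D ⟨
        + (D ∸ P′ ℕ.* P′)                           ∎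
        where
        open ≡-Reasoning
        e : ∀ Q c a P → Q * (c + + 2 * a * P - a * a * Q) ≡ Q * c + P * P - (a * Q - P) * (a * Q - P)
        e = solve-∀

      0<X : 0ℤ < X
      0<X = ℤₚ.*-cancelˡ-<-nonNeg (+ Q) (subst₂ _<_ (sym (ℤₚ.*-zeroʳ (+ Q))) (sym QX≡D-P′²)
        (+<+ (ℕₚ.m<n⇒0<n∸m (ℕₚ.≤-<-trans (ℕₚ.*-mono-≤ P′≤s P′≤s) isqrt²<D))))

      +∣X∣≡X : + ℤ.∣ X ∣ ≡ X
      +∣X∣≡X = 0<⇒+∣∣≡ 0<X

      nextQ≡∣X∣ : nextQ P Q ≡ ℤ.∣ X ∣
      nextQ≡∣X∣ = trans (divℕ-≡ _ Q) (trans (cong (_/ Q) D-P′²≡∣X∣Q) (ℕ.m*n/n≡m ℤ.∣ X ∣ Q))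
        where
        D-P′²≡∣X∣Q : D ∸ P′ ℕ.* P′ ≡ ℤ.∣ X ∣ ℕ.* Q
        D-P′²≡∣X∣Q = ℤₚ.+-injective (trans (sym QX≡D-P′²) (trans (cong (+ Q *_) (sym +∣X∣≡X))
          (trans (sym (ℤₚ.pos-* Q ℤ.∣ X ∣)) (cong +_ (ℕₚ.*-comm Q ℤ.∣ X ∣)))))

    nextQ-formula : + nextQ P Q ≡ + c + + 2 * + a * + P - + a * + a * + Q
    nextQ-formula = trans (cong +_ nextQ≡∣X∣) +∣X∣≡X

    private
      nextQ-norm : nextQ P Q ℕ.* Q ℕ.+ P′ ℕ.* P′ ≡ D
      nextQ-norm = ℤₚ.+-injective (begin
        + (nextQ P Q ℕ.* Q) + + (P′ ℕ.* P′)
          ≡⟨ cong (_+ + (P′ ℕ.* P′)) (trans (ℤₚ.pos-* (nextQ P Q) Q) (trans (ℤₚ.*-comm _ (+ Q)) (cong (+ Q *_) nextQ-formula))) ⟩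
        + Q * X + + (P′ ℕ.* P′)               ≡⟨ cong (_+ + (P′ ℕ.* P′)) QX≡D-P′² ⟩
        + (D ∸ P′ ℕ.* P′) + + (P′ ℕ.* P′)     ≡⟨ cong +_ (ℕₚ.m∸n+n≡m P′²≤D) ⟩
        + D                                   ∎)
        where open ≡-Reasoning

      -- Q X = D - P′² < (s + 1)² - P′² = (s + 1 - P′) (s + 1 + P′) ≤ Q (s + 1 + P′)
      X<s+1+P′ : X < + suc s + + P′
      X<s+1+P′ = ℤₚ.*-cancelˡ-<-nonNeg (+ Q) (begin-strict
        + Q * X                                  ≡⟨ QX≡D-P′² ⟩
        + (D ∸ P′ ℕ.* P′)                        ≡⟨ trans (pos-∸ P′²≤D) (cong (_-_ (+ D)) (ℤₚ.pos-* P′ P′)) ⟩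
        + D - + P′ * + P′                        <⟨ ℤₚ.+-monoˡ-< (- (+ P′ * + P′)) (subst (+ D <_) (ℤₚ.pos-* (suc s) (suc s)) (+<+ (<[isqrt+1]² D))) ⟩
        + suc s * + suc s - + P′ * + P′          ≡⟨ e (+ suc s) (+ P′) ⟩
        (+ suc s - + P′) * (+ suc s + + P′)      ≤⟨ ℤₚ.*-monoʳ-≤-nonNeg (+ suc s + + P′) s+1-P′≤Q ⟩
        + Q * (+ suc s + + P′)                   ∎)
        where
        open ℤₚ.≤-Reasoning
        e : ∀ t p → t * t - p * p ≡ (t - p) * (t + p)
        e = solve-∀
        s+1≤P′+Q : suc s ℕ.≤ P′ ℕ.+ Q
        s+1≤P′+Q = ℕₚ.+-cancelˡ-≤ P (suc s) (P′ ℕ.+ Q)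
          (subst₂ ℕ._≤_ (sym (ℕₚ.+-suc P s)) (trans (cong (ℕ._+ Q) (sym P+nextP≡quotient*Q)) (ℕₚ.+-assoc P P′ Q)) P+s<aQ+Q)
        s+1-P′≤Q : + suc s - + P′ ≤ + Q
        s+1-P′≤Q = subst (+ suc s - + P′ ≤_) (e′ (+ P′) (+ Q)) (ℤₚ.+-monoˡ-≤ (- + P′) (+≤+ s+1≤P′+Q))
          where
          e′ : ∀ p q → p + q - p ≡ q
          e′ = solve-∀

      ∣X∣≤P′+s : ℤ.∣ X ∣ ℕ.≤ P′ ℕ.+ s
      ∣X∣≤P′+s = ℕₚ.≤-pred (ℤₚ.drop‿+<+ (subst₂ _<_ (sym +∣X∣≡X) (cong (λ n → + suc n) (ℕₚ.+-comm s P′)) X<s+1+P′))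

    reduced-next : Reduced P′ (nextQ P Q) Q
    reduced-next = record
      { 1≤Q = subst (1 ℕ.≤_) (sym nextQ≡∣X∣) (0<⇒1≤∣∣ 0<X)
      ; P≤s = P′≤s
      ; Q≤P+s = subst (ℕ._≤ P′ ℕ.+ s) (sym nextQ≡∣X∣) ∣X∣≤P′+s
      ; norm = nextQ-norm
      }

module ContinuedFraction {D : ℕ} (2≤D : 2 ℕ.≤ D) (squareFree : SquareFree D) where

  open ReductionStep D (isqrt²<D 2≤D squareFree)

  -- ω_D = [a 0; a 1, a 2, …], with complete quotients (P k + √D) / Q k
  P Q a : ℕ → ℕ
  P k = proj₁ (cfState D k)
  Q k = proj₂ (cfState D k)
  a k = cfA D k

  private
    c : ℕ → ℕ
    c zero = if oneMod4 D then 2 ℕ.* (D / 4) else D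
    c (suc k) = Q k

    reduced₀ : Reduced (P 0) (Q 0) (c 0)
    reduced₀ with oneMod4 D in eq
    ... | true = record { 1≤Q = s≤s z≤n ; P≤s = 1≤isqrt 2≤D squareFree ; Q≤P+s = s≤s (1≤isqrt 2≤D squareFree) ; norm = D≡4q+1 }
      where
      D≡4q+1 : 2 ℕ.* (2 ℕ.* (D / 4)) ℕ.+ 1 ≡ D
      D≡4q+1 = trans (e (D / 4)) (trans (cong (ℕ._+ (D / 4) ℕ.* 4) (sym (ℕₚ.≡ᵇ⇒≡ (D % 4) 1 (subst T (sym eq) _))))
                                        (sym (ℕ.m≡m%n+[m/n]*n D 4)))
        where
        e : ∀ q → 2 ℕ.* (2 ℕ.* q) ℕ.+ 1 ≡ 1 ℕ.+ q ℕ.* 4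
        e = ℕ-Ring.solve-∀
    ... | false = record
      { 1≤Q = s≤s z≤n ; P≤s = z≤n ; Q≤P+s = 1≤isqrt 2≤D squareFree ; norm = trans (ℕₚ.+-identityʳ _) (ℕₚ.*-identityˡ D) }

  reduced : ∀ k → Reduced (P k) (Q k) (c k)
  reduced zero = reduced₀
  reduced (suc k) = reduced-next (reduced k)

  1≤a : ∀ k → 1 ℕ.≤ a k
  1≤a k = 1≤quotient (reduced k)

  1≤Q : ∀ k → 1 ℕ.≤ Q k
  1≤Q k = Reduced.1≤Q (reduced k)

  P-recurrence : ∀ k → + P (suc k) ≡ + a k * + Q k - + P k
  P-recurrence k = trans (e (+ P (suc k)) (+ P k)) (cong (_- + P k) (trans (cong +_ (P+nextP≡quotient*Q (reduced k))) (ℤₚ.pos-* (a k) (Q k))))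
    where
    e : ∀ x p → x ≡ p + x - p
    e = solve-∀

  Q-recurrence : ∀ k → + Q (suc (suc k)) ≡ + Q k + + 2 * + a (suc k) * + P (suc k) - + a (suc k) * + a (suc k) * + Q (suc k)
  Q-recurrence k = nextQ-formula (reduced (suc k))

  -- p m and q m are the paper's p_{m-1} and q_{m-1}
  p q : ℕ → ℤ
  p m = + Pc D m
  q m = + Qc D m

  p-recurrence : ∀ m → p (suc (suc m)) ≡ + a (suc m) * p (suc m) + p m
  p-recurrence m = cong (_+ p m) (ℤₚ.pos-* (a (suc m)) (Pc D (suc m)))

  q-recurrence : ∀ m → q (suc (suc m)) ≡ + a (suc m) * q (suc m) + q m
  q-recurrence m = cong (_+ q m) (ℤₚ.pos-* (a (suc m)) (Qc D (suc m)))

  det-convergents : ∀ m → p m * q (suc m) - q m * p (suc m) ≡ -1ℤ ^ m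
  det-convergents zero = e (+ a 0)
    where
    e : ∀ x → + 1 * + 1 - + 0 * x ≡ 1ℤ
    e = solve-∀
  det-convergents (suc m) = begin
    p (suc m) * q (suc (suc m)) - q (suc m) * p (suc (suc m))
      ≡⟨ cong₂ (λ x y → p (suc m) * x - q (suc m) * y) (q-recurrence m) (p-recurrence m) ⟩
    p (suc m) * (+ a (suc m) * q (suc m) + q m) - q (suc m) * (+ a (suc m) * p (suc m) + p m)
      ≡⟨ e (+ a (suc m)) (p (suc m)) (p m) (q (suc m)) (q m) ⟩
    -1ℤ * (p m * q (suc m) - q m * p (suc m))
      ≡⟨ cong (-1ℤ *_) (det-convergents m) ⟩
    -1ℤ ^ suc m ∎
    where
    open ≡-Reasoning
    e : ∀ α p₁ p₀ q₁ q₀ → p₁ * (α * q₁ + q₀) - q₁ * (α * p₁ + p₀) ≡ -1ℤ * (p₀ * q₁ - q₀ * p₁)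
    e = solve-∀

  -- Q₀ (p m + q m ξ_D) = A m + q m √D
  A : ℕ → ℤ
  A m = + Q₀ D * p m - + P₀ D * q m

  A-recurrence : ∀ m → A (suc (suc m)) ≡ + a (suc m) * A (suc m) + A m
  A-recurrence m = trans (cong₂ (λ x y → + Q₀ D * x - + P₀ D * y) (p-recurrence m) (q-recurrence m))
    (e (+ Q₀ D) (+ P₀ D) (+ a (suc m)) (p (suc m)) (p m) (q (suc m)) (q m))
    where
    e : ∀ Q₀ P₀ α p₁ p₀ q₁ q₀ → Q₀ * (α * p₁ + p₀) - P₀ * (α * q₁ + q₀) ≡ α * (Q₀ * p₁ - P₀ * q₁) + (Q₀ * p₀ - P₀ * q₀)
    e = solve-∀

  -- Q₀² times the norm of the convergent, and the corresponding bilinear cross term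
  N C : ℕ → ℤ
  N m = A m * A m - + D * (q m * q m)
  C m = A (suc m) * A m - + D * (q (suc m) * q m)

  private
    -- N and C obey the same three-term recurrences as (-1)^m Q₀ Q_m and (-1)^m Q₀ P_{m+1}
    norm-cross : ∀ m → N (suc m) ≡ -1ℤ ^ suc m * + Q₀ D * + Q (suc m) × N m ≡ -1ℤ ^ m * + Q₀ D * + Q m ×
                       C m ≡ -1ℤ ^ m * + Q₀ D * + P (suc m)
    norm-cross zero =
      N₁ , e₀ (+ Q₀ D) (+ P₀ D) (+ D) , trans (cong (λ x → x * A 0 - + D * (+ 1 * + 0)) A₁) (e₁ (+ P 1) (+ Q₀ D) (+ P₀ D) (+ D))
      where
      A₁ : A 1 ≡ + P 1
      A₁ = trans (e (+ Q₀ D) (+ a 0) (+ P₀ D)) (sym (P-recurrence 0))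
        where
        e : ∀ q α p → q * α - p * + 1 ≡ α * q - p
        e = solve-∀
      D≡ : + D ≡ + Q 1 * + Q 0 + + P 1 * + P 1
      D≡ = trans (cong +_ (sym (Reduced.norm (reduced 1)))) (cong₂ _+_ (ℤₚ.pos-* (Q 1) (Q 0)) (ℤₚ.pos-* (P 1) (P 1)))
      N₁ : N 1 ≡ -1ℤ ^ 1 * + Q₀ D * + Q 1
      N₁ = trans (cong₂ (λ x d → x * x - d * (+ 1 * + 1)) A₁ D≡) (e (+ Q 1) (+ Q 0) (+ P 1))
        where
        e : ∀ q₁ q₀ p₁ → p₁ * p₁ - (q₁ * q₀ + p₁ * p₁) * (+ 1 * + 1) ≡ -1ℤ * 1ℤ * q₀ * q₁
        e = solve-∀
      e₀ : ∀ q p d → (q * + 1 - p * + 0) * (q * + 1 - p * + 0) - d * (+ 0 * + 0) ≡ 1ℤ * q * q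
      e₀ = solve-∀
      e₁ : ∀ p₁ q p d → p₁ * (q * + 1 - p * + 0) - d * (+ 1 * + 0) ≡ 1ℤ * q * p₁
      e₁ = solve-∀
    norm-cross (suc m) with norm-cross m
    ... | N₁≡ , N₀≡ , C₀≡ = N₂≡ , N₁≡ , C₁≡
      where
      open ≡-Reasoning
      α = + a (suc m)
      g = -1ℤ ^ m
      N₂≡ : N (suc (suc m)) ≡ -1ℤ ^ suc (suc m) * + Q₀ D * + Q (suc (suc m))
      N₂≡ = begin
        N (suc (suc m))
          ≡⟨ cong₂ (λ x y → x * x - + D * (y * y)) (A-recurrence m) (q-recurrence m) ⟩
        (α * A (suc m) + A m) * (α * A (suc m) + A m) - + D * ((α * q (suc m) + q m) * (α * q (suc m) + q m))
          ≡⟨ e α (A (suc m)) (A m) (q (suc m)) (q m) (+ D) ⟩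
        α * α * N (suc m) + + 2 * α * C m + N m
          ≡⟨ cong₂ _+_ (cong₂ (λ x y → α * α * x + + 2 * α * y) N₁≡ C₀≡) N₀≡ ⟩
        α * α * (-1ℤ * g * + Q₀ D * + Q (suc m)) + + 2 * α * (g * + Q₀ D * + P (suc m)) + g * + Q₀ D * + Q m
          ≡⟨ e′ g (+ Q₀ D) (+ Q (suc m)) (+ P (suc m)) (+ Q m) α ⟩
        -1ℤ * (-1ℤ * g) * + Q₀ D * (+ Q m + + 2 * α * + P (suc m) - α * α * + Q (suc m))
          ≡⟨ cong (-1ℤ * (-1ℤ * g) * + Q₀ D *_) (Q-recurrence m) ⟨
        -1ℤ ^ suc (suc m) * + Q₀ D * + Q (suc (suc m)) ∎
        where
        e : ∀ α A₁ A₀ q₁ q₀ d → (α * A₁ + A₀) * (α * A₁ + A₀) - d * ((α * q₁ + q₀) * (α * q₁ + q₀))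
                               ≡ α * α * (A₁ * A₁ - d * (q₁ * q₁)) + + 2 * α * (A₁ * A₀ - d * (q₁ * q₀)) + (A₀ * A₀ - d * (q₀ * q₀))
        e = solve-∀
        e′ : ∀ g Q₀ Q₁ P₁ Qₘ α → α * α * (-1ℤ * g * Q₀ * Q₁) + + 2 * α * (g * Q₀ * P₁) + g * Q₀ * Qₘ
                                 ≡ -1ℤ * (-1ℤ * g) * Q₀ * (Qₘ + + 2 * α * P₁ - α * α * Q₁)
        e′ = solve-∀
      C₁≡ : C (suc m) ≡ -1ℤ ^ suc m * + Q₀ D * + P (suc (suc m))
      C₁≡ = begin
        C (suc m)
          ≡⟨ cong₂ (λ x y → x * A (suc m) - + D * (y * q (suc m))) (A-recurrence m) (q-recurrence m) ⟩
        (α * A (suc m) + A m) * A (suc m) - + D * ((α * q (suc m) + q m) * q (suc m))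
          ≡⟨ e α (A (suc m)) (A m) (q (suc m)) (q m) (+ D) ⟩
        α * N (suc m) + C m
          ≡⟨ cong₂ (λ x y → α * x + y) N₁≡ C₀≡ ⟩
        α * (-1ℤ * g * + Q₀ D * + Q (suc m)) + g * + Q₀ D * + P (suc m)
          ≡⟨ e′ g (+ Q₀ D) (+ Q (suc m)) (+ P (suc m)) α ⟩
        -1ℤ * g * + Q₀ D * (α * + Q (suc m) - + P (suc m))
          ≡⟨ cong (-1ℤ * g * + Q₀ D *_) (P-recurrence (suc m)) ⟨
        -1ℤ ^ suc m * + Q₀ D * + P (suc (suc m)) ∎
        where
        e : ∀ α A₁ A₀ q₁ q₀ d → (α * A₁ + A₀) * A₁ - d * ((α * q₁ + q₀) * q₁) ≡ α * (A₁ * A₁ - d * (q₁ * q₁)) + (A₁ * A₀ - d * (q₁ * q₀))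
        e = solve-∀
        e′ : ∀ g Q₀ Q₁ P₁ α → α * (-1ℤ * g * Q₀ * Q₁) + g * Q₀ * P₁ ≡ -1ℤ * g * Q₀ * (α * Q₁ - P₁)
        e′ = solve-∀

  norm-identity : ∀ m → N m ≡ -1ℤ ^ m * + Q₀ D * + Q m
  norm-identity m = proj₁ (proj₂ (norm-cross m))

  private
    -1^even : ∀ k → -1ℤ ^ (2 ℕ.* k) ≡ 1ℤ
    -1^even k = trans (sym (ℤₚ.^-*-assoc -1ℤ 2 k)) (ℤₚ.^-zeroˡ k)

    1≤Qc : ∀ m → 1 ℕ.≤ Qc D (suc m)
    1≤Qc zero = s≤s z≤n
    1≤Qc (suc m) = ℕₚ.≤-trans (1≤Qc m) (ℕₚ.≤-trans (ℕₚ.m≤n*m (Qc D (suc m)) (a (suc m)) {{ℕ.>-nonZero (1≤a (suc m))}}) (ℕₚ.m≤m+n _ _))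

    P₀≤1 : P₀ D ℕ.≤ 1
    P₀≤1 with oneMod4 D
    ... | true = s≤s z≤n
    ... | false = z≤n

    0<Q₀Q : ∀ m → 0ℤ < + Q₀ D * + Q m
    0<Q₀Q m = *-pos (+<+ (1≤Q 0)) (+<+ (1≤Q m))

  convergent-even : ∀ k → TotPosSurd D (A (2 ℕ.* k)) (q (2 ℕ.* k))
  convergent-even k = 0<A , q²D<A²
    where
    Aₖ = A (2 ℕ.* k)
    qₖ = q (2 ℕ.* k)
    q²D<A² : qₖ * qₖ * + D < Aₖ * Aₖ
    q²D<A² = subst (_< Aₖ * Aₖ) (ℤₚ.*-comm (+ D) (qₖ * qₖ)) (0<j-i⇒i<j (subst (0ℤ <_) (sym N≡) (0<Q₀Q (2 ℕ.* k))))
      where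
      N≡ : N (2 ℕ.* k) ≡ + Q₀ D * + Q (2 ℕ.* k)
      N≡ = trans (norm-identity (2 ℕ.* k))
        (trans (cong (λ g → g * + Q₀ D * + Q (2 ℕ.* k)) (-1^even k)) (cong (_* + Q (2 ℕ.* k)) (ℤₚ.*-identityˡ (+ Q₀ D))))
    -- A + q = Q₀ p + (1 - P₀) q ≥ 0, so A ≤ 0 would give A² ≤ q² ≤ q² D
    -A≤q : - Aₖ ≤ qₖ
    -A≤q = ℤₚ.0≤i-j⇒j≤i (subst (0ℤ ≤_) (e (+ Q₀ D) (p (2 ℕ.* k)) (+ P₀ D) qₖ)
      (ℤₚ.+-mono-≤ (*-nonNeg {+ Q₀ D} {p (2 ℕ.* k)} (+≤+ z≤n) (+≤+ z≤n))
                   (*-nonNeg {+ 1 - + P₀ D} {qₖ} (ℤₚ.i≤j⇒0≤j-i (+≤+ P₀≤1)) (+≤+ z≤n))))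
      where
      e : ∀ Q₀ p P₀ q → Q₀ * p + (+ 1 - P₀) * q ≡ q - - (Q₀ * p - P₀ * q)
      e = solve-∀
    0<A : 0ℤ < Aₖ
    0<A = ℤₚ.≰⇒> λ A≤0 → ℤₚ.<-irrefl refl (ℤₚ.<-≤-trans q²D<A² (A²≤q²D (ℤₚ.neg-mono-≤ A≤0)))
      where
      A²≤q²D : 0ℤ ≤ - Aₖ → Aₖ * Aₖ ≤ qₖ * qₖ * + D
      A²≤q²D 0≤-A = begin
        Aₖ * Aₖ               ≡⟨ neg-square Aₖ ⟨
        (- Aₖ) * (- Aₖ)       ≤⟨ ℤₚ.*-monoˡ-≤-nonNeg (- Aₖ) {{ℤ.nonNegative 0≤-A}} -A≤q ⟩
        (- Aₖ) * qₖ           ≤⟨ ℤₚ.*-monoʳ-≤-nonNeg qₖ {{ℤ.nonNegative (ℤₚ.≤-trans 0≤-A -A≤q)}} -A≤q ⟩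
        qₖ * qₖ               ≡⟨ ℤₚ.*-identityʳ (qₖ * qₖ) ⟨
        qₖ * qₖ * 1ℤ          ≤⟨ ℤₚ.*-monoˡ-≤-nonNeg (qₖ * qₖ) {{ℤ.nonNegative (square-nonNeg qₖ)}} (+≤+ (ℕₚ.≤-trans (s≤s z≤n) 2≤D)) ⟩
        qₖ * qₖ * + D         ∎
        where open ℤₚ.≤-Reasoning

  convergent-odd : ∀ k → MixedSurd D (A (suc (2 ℕ.* k))) (q (suc (2 ℕ.* k)))
  convergent-odd k = +<+ (1≤Qc (2 ℕ.* k)) ,
    subst (A m * A m <_) (ℤₚ.*-comm (+ D) (q m * q m)) (0<j-i⇒i<j (subst (0ℤ <_) (sym -N≡) (0<Q₀Q m)))
    where
    m = suc (2 ℕ.* k)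
    -N≡ : + D * (q m * q m) - A m * A m ≡ + Q₀ D * + Q m
    -N≡ = begin
      + D * (q m * q m) - A m * A m    ≡⟨ e (A m) (q m) (+ D) ⟩
      -1ℤ * N m                        ≡⟨ cong (-1ℤ *_) (norm-identity m) ⟩
      -1ℤ * (-1ℤ ^ m * + Q₀ D * + Q m) ≡⟨ cong (λ g → -1ℤ * (-1ℤ * g * + Q₀ D * + Q m)) (-1^even k) ⟩
      -1ℤ * (-1ℤ * 1ℤ * + Q₀ D * + Q m) ≡⟨ e′ (+ Q₀ D) (+ Q m) ⟩
      + Q₀ D * + Q m                   ∎
      where
      open ≡-Reasoning
      e : ∀ A q d → d * (q * q) - A * A ≡ -1ℤ * (A * A - d * (q * q))
      e = solve-∀
      e′ : ∀ x y → -1ℤ * (-1ℤ * 1ℤ * x * y) ≡ x * y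
      e′ = solve-∀

  -- β n = α_{2k-1} + r α_{2k} (paper's indexing) for (k , r) = betaIdx D n
  kβ rβ : ℕ → ℕ
  kβ n = proj₁ (betaIdx D n)
  rβ n = proj₂ (betaIdx D n)

  uᵒ : ℕ → ℕ
  uᵒ k = u D (suc (2 ℕ.* k))

  data Successor (k r : ℕ) (next : ℕ × ℕ) : Set where
    same-block : proj₁ next ≡ k → proj₂ next ≡ suc r → suc r ℕ.< uᵒ k → Successor k r next
    next-block : proj₁ next ≡ suc k → proj₂ next ≡ 0 → suc r ≡ uᵒ k → Successor k r next

  private
    successor : ∀ k r → r ℕ.< uᵒ k → Successor k r (if suc r ℕ.<ᵇ uᵒ k then (k , suc r) else (suc k , 0))
    successor k r r<u with suc r ℕ.<ᵇ uᵒ k in eq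
    ... | true = same-block refl refl (ℕₚ.<ᵇ⇒< (suc r) (uᵒ k) (subst T (sym eq) _))
    ... | false = next-block refl refl (ℕₚ.≤-antisym r<u (ℕₚ.≮⇒≥ λ r+1<u → subst T eq (ℕₚ.<⇒<ᵇ r+1<u)))

  rβ<uᵒ : ∀ n → rβ n ℕ.< uᵒ (kβ n)
  successor-of : ∀ n → Successor (kβ n) (rβ n) (betaIdx D (suc n))
  successor-of n = successor (kβ n) (rβ n) (rβ<uᵒ n)
  rβ<uᵒ zero = 1≤a 1
  rβ<uᵒ (suc n) with successor-of n
  ... | same-block k≡ r≡ r+1<u = subst₂ (λ r k → r ℕ.< uᵒ k) (sym r≡) (sym k≡) r+1<u
  ... | next-block k≡ r≡ _ = subst₂ (λ r k → r ℕ.< uᵒ k) (sym r≡) (sym k≡) (1≤a (suc (2 ℕ.* suc (kβ n))))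

  private
    2[1+k] : ∀ k → 2 ℕ.* suc k ≡ suc (suc (2 ℕ.* k))
    2[1+k] = ℕ-Ring.solve-∀

  -- f n stands for Pc D n or Qc D n, βcoeff f for the corresponding coordinate of β
  EvenStep OddStep : (ℕ → ℕ) → Set
  EvenStep f = ∀ k → f (2 ℕ.* suc k) ≡ uᵒ k ℕ.* f (suc (2 ℕ.* k)) ℕ.+ f (2 ℕ.* k)
  OddStep f = ∀ k → f (suc (2 ℕ.* suc k)) ≡ u D (2 ℕ.* suc k) ℕ.* f (2 ℕ.* suc k) ℕ.+ f (suc (2 ℕ.* k))

  Pc-even : EvenStep (Pc D)
  Pc-even k = cong (Pc D) (2[1+k] k)

  Qc-even : EvenStep (Qc D)
  Qc-even k = cong (Qc D) (2[1+k] k)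

  Pc-odd : OddStep (Pc D)
  Pc-odd k = trans (cong (λ t → Pc D (suc t)) (2[1+k] k)) (cong (λ t → u D t ℕ.* Pc D t ℕ.+ Pc D (suc (2 ℕ.* k))) (sym (2[1+k] k)))

  Qc-odd : OddStep (Qc D)
  Qc-odd k = trans (cong (λ t → Qc D (suc t)) (2[1+k] k)) (cong (λ t → u D t ℕ.* Qc D t ℕ.+ Qc D (suc (2 ℕ.* k))) (sym (2[1+k] k)))

  βcoeff : (ℕ → ℕ) → ℕ → ℕ
  βcoeff f n = f (2 ℕ.* kβ n) ℕ.+ rβ n ℕ.* f (suc (2 ℕ.* kβ n))

  βcoeff-step : ∀ f → EvenStep f → ∀ n → βcoeff f (suc n) ≡ βcoeff f n ℕ.+ f (suc (2 ℕ.* kβ n))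
  βcoeff-step f even n with successor-of n
  ... | same-block k≡ r≡ _ = trans (cong₂ (λ k r → f (2 ℕ.* k) ℕ.+ r ℕ.* f (suc (2 ℕ.* k))) k≡ r≡)
                                   (e (f (2 ℕ.* kβ n)) (rβ n) (f (suc (2 ℕ.* kβ n))))
    where
    e : ∀ x r y → x ℕ.+ suc r ℕ.* y ≡ x ℕ.+ r ℕ.* y ℕ.+ y
    e = ℕ-Ring.solve-∀
  ... | next-block k≡ r≡ r+1≡u = begin
    βcoeff f (suc n)                                                  ≡⟨ cong₂ (λ k r → f (2 ℕ.* k) ℕ.+ r ℕ.* f (suc (2 ℕ.* k))) k≡ r≡ ⟩
    f (2 ℕ.* suc (kβ n)) ℕ.+ 0                                      ≡⟨ cong (ℕ._+ 0) (even (kβ n)) ⟩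
    uᵒ (kβ n) ℕ.* f (suc (2 ℕ.* kβ n)) ℕ.+ f (2 ℕ.* kβ n) ℕ.+ 0     ≡⟨ cong (λ w → w ℕ.* f (suc (2 ℕ.* kβ n)) ℕ.+ f (2 ℕ.* kβ n) ℕ.+ 0) (sym r+1≡u) ⟩
    suc (rβ n) ℕ.* f (suc (2 ℕ.* kβ n)) ℕ.+ f (2 ℕ.* kβ n) ℕ.+ 0   ≡⟨ e (f (2 ℕ.* kβ n)) (rβ n) (f (suc (2 ℕ.* kβ n))) ⟩
    βcoeff f n ℕ.+ f (suc (2 ℕ.* kβ n))                               ∎
    where
    open ≡-Reasoning
    e : ∀ x r y → suc r ℕ.* y ℕ.+ x ℕ.+ 0 ≡ x ℕ.+ r ℕ.* y ℕ.+ y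
    e = ℕ-Ring.solve-∀

  βcoeff-recurrence : ∀ f → EvenStep f → OddStep f → ∀ m →
                    βcoeff f m ℕ.+ βcoeff f (suc (suc m)) ≡ v D (+ suc m) ℕ.* βcoeff f (suc m)
  βcoeff-recurrence f even odd m with successor-of m
  ... | same-block k≡ r≡ _ = begin
    βcoeff f m ℕ.+ βcoeff f (suc (suc m))             ≡⟨ cong (βcoeff f m ℕ.+_) (βcoeff-step f even (suc m)) ⟩
    βcoeff f m ℕ.+ (βcoeff f (suc m) ℕ.+ f (suc (2 ℕ.* kβ (suc m))))
      ≡⟨ cong (λ k → βcoeff f m ℕ.+ (βcoeff f (suc m) ℕ.+ f (suc (2 ℕ.* k)))) k≡ ⟩
    βcoeff f m ℕ.+ (βcoeff f (suc m) ℕ.+ y)           ≡⟨ cong (λ z → βcoeff f m ℕ.+ (z ℕ.+ y)) (βcoeff-step f even m) ⟩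
    βcoeff f m ℕ.+ ((βcoeff f m ℕ.+ y) ℕ.+ y)         ≡⟨ e (βcoeff f m) y ⟩
    2 ℕ.* (βcoeff f m ℕ.+ y)                        ≡⟨ cong (2 ℕ.*_) (βcoeff-step f even m) ⟨
    2 ℕ.* βcoeff f (suc m)                          ≡⟨ cong (λ r → (if r ℕ.≡ᵇ 0 then u D (2 ℕ.* kβ (suc m)) ℕ.+ 2 else 2) ℕ.* βcoeff f (suc m)) (sym r≡) ⟩
    v D (+ suc m) ℕ.* βcoeff f (suc m)              ∎
    where
    open ≡-Reasoning
    y = f (suc (2 ℕ.* kβ m))
    e : ∀ x y → x ℕ.+ ((x ℕ.+ y) ℕ.+ y) ≡ 2 ℕ.* (x ℕ.+ y)
    e = ℕ-Ring.solve-∀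
  ... | next-block k≡ r≡ _ = begin
    βcoeff f m ℕ.+ βcoeff f (suc (suc m))             ≡⟨ cong (βcoeff f m ℕ.+_) (βcoeff-step f even (suc m)) ⟩
    βcoeff f m ℕ.+ (βcoeff f (suc m) ℕ.+ f (suc (2 ℕ.* kβ (suc m))))
      ≡⟨ cong (λ k → βcoeff f m ℕ.+ (βcoeff f (suc m) ℕ.+ f (suc (2 ℕ.* k)))) k≡ ⟩
    βcoeff f m ℕ.+ (βcoeff f (suc m) ℕ.+ f (suc (2 ℕ.* suc k)))
      ≡⟨ cong (λ z → βcoeff f m ℕ.+ (βcoeff f (suc m) ℕ.+ z)) (odd k) ⟩
    βcoeff f m ℕ.+ (βcoeff f (suc m) ℕ.+ (U ℕ.* f (2 ℕ.* suc k) ℕ.+ y))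
      ≡⟨ cong (λ z → βcoeff f m ℕ.+ (βcoeff f (suc m) ℕ.+ (U ℕ.* z ℕ.+ y))) (sym βcoeff[m+1]) ⟩
    βcoeff f m ℕ.+ (βcoeff f (suc m) ℕ.+ (U ℕ.* βcoeff f (suc m) ℕ.+ y))
      ≡⟨ e (βcoeff f m) (βcoeff f (suc m)) U y ⟩
    (βcoeff f m ℕ.+ y) ℕ.+ βcoeff f (suc m) ℕ.+ U ℕ.* βcoeff f (suc m)
      ≡⟨ cong (λ z → z ℕ.+ βcoeff f (suc m) ℕ.+ U ℕ.* βcoeff f (suc m)) (βcoeff-step f even m) ⟨
    βcoeff f (suc m) ℕ.+ βcoeff f (suc m) ℕ.+ U ℕ.* βcoeff f (suc m)
      ≡⟨ e′ (βcoeff f (suc m)) U ⟩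
    (U ℕ.+ 2) ℕ.* βcoeff f (suc m)
      ≡⟨ cong (λ k → (u D (2 ℕ.* k) ℕ.+ 2) ℕ.* βcoeff f (suc m)) (sym k≡) ⟩
    (u D (2 ℕ.* kβ (suc m)) ℕ.+ 2) ℕ.* βcoeff f (suc m)
      ≡⟨ cong (λ r → (if r ℕ.≡ᵇ 0 then u D (2 ℕ.* kβ (suc m)) ℕ.+ 2 else 2) ℕ.* βcoeff f (suc m)) (sym r≡) ⟩
    v D (+ suc m) ℕ.* βcoeff f (suc m)              ∎
    where
    open ≡-Reasoning
    k = kβ m
    y = f (suc (2 ℕ.* k))
    U = u D (2 ℕ.* suc k)
    βcoeff[m+1] : βcoeff f (suc m) ≡ f (2 ℕ.* suc k)
    βcoeff[m+1] = trans (cong₂ (λ k r → f (2 ℕ.* k) ℕ.+ r ℕ.* f (suc (2 ℕ.* k))) k≡ r≡) (ℕₚ.+-identityʳ _)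
    e : ∀ a b c d → a ℕ.+ (b ℕ.+ (c ℕ.* b ℕ.+ d)) ≡ (a ℕ.+ d) ℕ.+ b ℕ.+ c ℕ.* b
    e = ℕ-Ring.solve-∀
    e′ : ∀ b c → b ℕ.+ b ℕ.+ c ℕ.* b ≡ (c ℕ.+ 2) ℕ.* b
    e′ = ℕ-Ring.solve-∀

  β : ℕ → OK
  β n = beta D (+ n)

  private
    pos-βcoeff : ∀ f n → + βcoeff f n ≡ + f (2 ℕ.* kβ n) + + rβ n * + f (suc (2 ℕ.* kβ n))
    pos-βcoeff f n = cong (_+_ (+ f (2 ℕ.* kβ n))) (ℤₚ.pos-* (rβ n) (f (suc (2 ℕ.* kβ n))))

    -- u (α_{2k-1} + r α_{2k}) = (u - r) α_{2k-1} + r α_{2k+1} for 0 < r < u = u_{2k+1}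
    combination : ∀ k r → r ℕ.< uᵒ k →
                  TotPosSurd D (A (2 ℕ.* k) + + r * A (suc (2 ℕ.* k))) (q (2 ℕ.* k) + + r * q (suc (2 ℕ.* k)))
    combination k zero _ = subst₂ (TotPosSurd D) (e (A (2 ℕ.* k)) (A (suc (2 ℕ.* k)))) (e (q (2 ℕ.* k)) (q (suc (2 ℕ.* k)))) (convergent-even k)
      where
      e : ∀ x y → x ≡ x + + 0 * y
      e = solve-∀
    combination k (suc r) r<u = TotPosSurd-*⁻¹ {n = + uᵒ k} (+<+ (ℕₚ.<-trans (s≤s z≤n) r<u))
      (subst₂ (TotPosSurd D) (rearrange (A (2 ℕ.* k)) (A (suc (2 ℕ.* k)))) (rearrange (q (2 ℕ.* k)) (q (suc (2 ℕ.* k))))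
        (TotPosSurd-+ (TotPosSurd-* {n = + suc t} (+<+ (s≤s z≤n)) (convergent-even k)) (TotPosSurd-* {n = + suc r} (+<+ (s≤s z≤n)) next)))
      where
      t = uᵒ k ∸ suc (suc r)
      u≡ : uᵒ k ≡ suc r ℕ.+ suc t
      u≡ = trans (sym (ℕₚ.m+[n∸m]≡n r<u)) (sym (ℕₚ.+-suc (suc r) t))
      next : TotPosSurd D (+ uᵒ k * A (suc (2 ℕ.* k)) + A (2 ℕ.* k)) (+ uᵒ k * q (suc (2 ℕ.* k)) + q (2 ℕ.* k))
      next = subst₂ (TotPosSurd D) (trans (cong A (2[1+k] k)) (A-recurrence (2 ℕ.* k))) (trans (cong q (2[1+k] k)) (q-recurrence (2 ℕ.* k)))
        (convergent-even (suc k))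
      e : ∀ R T x₀ x₁ → T * x₀ + R * ((R + T) * x₁ + x₀) ≡ (R + T) * (x₀ + R * x₁)
      e = solve-∀
      rearrange : ∀ x₀ x₁ → + suc t * x₀ + + suc r * (+ uᵒ k * x₁ + x₀) ≡ + uᵒ k * (x₀ + + suc r * x₁)
      rearrange x₀ x₁ = subst (λ U → + suc t * x₀ + + suc r * (U * x₁ + x₀) ≡ U * (x₀ + + suc r * x₁))
        (sym (cong +_ u≡)) (e (+ suc r) (+ suc t) x₀ x₁)

    proj₂-fromXi : ∀ x y → proj₂ (fromXi D x y) ≡ y
    proj₂-fromXi x y = cong proj₂ (fromXi-≡ D x y)

  β-TotPos : ∀ n → TotPos D (β n)
  β-TotPos n = TotPosSurd⇒TotPos D (β n) (subst₂ (TotPosSurd D) (sym rat≡) (sym (trans (proj₂-fromXi _ _) (pos-βcoeff (Qc D) n)))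
    (combination (kβ n) (rβ n) (rβ<uᵒ n)))
    where
    k = kβ n
    rat≡ : rat D (β n) ≡ A (2 ℕ.* k) + + rβ n * A (suc (2 ℕ.* k))
    rat≡ = trans (rat-fromXi D _ _) (trans (cong₂ (λ x y → + Q₀ D * x - + P₀ D * y) (pos-βcoeff (Pc D) n) (pos-βcoeff (Qc D) n))
      (e (+ Q₀ D) (+ P₀ D) (p (2 ℕ.* k)) (p (suc (2 ℕ.* k))) (q (2 ℕ.* k)) (q (suc (2 ℕ.* k))) (+ rβ n)))
      where
      e : ∀ Q₀ P₀ p₀ p₁ q₀ q₁ r → Q₀ * (p₀ + r * p₁) - P₀ * (q₀ + r * q₁) ≡ Q₀ * p₀ - P₀ * q₀ + r * (Q₀ * p₁ - P₀ * q₁)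
      e = solve-∀

  β-step : ∀ n → β (suc n) ≡ β n ⊕ fromXi D (p (suc (2 ℕ.* kβ n))) (q (suc (2 ℕ.* kβ n)))
  β-step n = trans (cong₂ (λ x y → fromXi D (+ x) (+ y)) (βcoeff-step (Pc D) Pc-even n) (βcoeff-step (Qc D) Qc-even n))
    (sym (fromXi-⊕ D _ _ _ _))

  β-det : ∀ n → det (β n) (β (suc n)) ≡ 1ℤ
  β-det n = begin
    det (β n) (β (suc n))
      ≡⟨ cong (det (β n)) (β-step n) ⟩
    det (β n) (β n ⊕ fromXi D p₁ q₁)
      ≡⟨ cong (det (β n)) (fromXi-⊕ D _ _ p₁ q₁) ⟩
    det (fromXi D x y) (fromXi D (x + p₁) (y + q₁))
      ≡⟨ det-fromXi D x y _ _ ⟩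
    x * (y + q₁) - y * (x + p₁)
      ≡⟨ cong₂ (λ x y → x * (y + q₁) - y * (x + p₁)) (pos-βcoeff (Pc D) n) (pos-βcoeff (Qc D) n) ⟩
    (p₀ + r * p₁) * (q₀ + r * q₁ + q₁) - (q₀ + r * q₁) * (p₀ + r * p₁ + p₁)
      ≡⟨ e p₀ p₁ q₀ q₁ r ⟩
    p₀ * q₁ - q₀ * p₁
      ≡⟨ trans (det-convergents (2 ℕ.* kβ n)) (-1^even (kβ n)) ⟩
    1ℤ ∎
    where
    open ≡-Reasoning
    x = + βcoeff (Pc D) n
    y = + βcoeff (Qc D) n
    p₀ = p (2 ℕ.* kβ n)
    q₀ = q (2 ℕ.* kβ n)
    p₁ = p (suc (2 ℕ.* kβ n))
    q₁ = q (suc (2 ℕ.* kβ n))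
    r = + rβ n
    e : ∀ p₀ p₁ q₀ q₁ r → (p₀ + r * p₁) * (q₀ + r * q₁ + q₁) - (q₀ + r * q₁) * (p₀ + r * p₁ + p₁) ≡ p₀ * q₁ - q₀ * p₁
    e = solve-∀

  β-Mixed : ∀ n → Mixed D (β (suc n) ⊖ β n)
  β-Mixed n = subst₂ (MixedSurd D) (sym rat≡) (sym q≡) (convergent-odd (kβ n))
    where
    k = kβ n
    diff≡ : β (suc n) ⊖ β n ≡ fromXi D (p (suc (2 ℕ.* k))) (q (suc (2 ℕ.* k)))
    diff≡ = trans (fromXi-⊖ D (+ βcoeff (Pc D) n) (+ βcoeff (Qc D) n) (+ βcoeff (Pc D) (suc n)) (+ βcoeff (Qc D) (suc n)))
      (cong₂ (fromXi D) (step-diff (Pc D) Pc-even) (step-diff (Qc D) Qc-even))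
      where
      e : ∀ a b → a + b - a ≡ b
      e = solve-∀
      step-diff : ∀ f → EvenStep f → + βcoeff f (suc n) - + βcoeff f n ≡ + f (suc (2 ℕ.* k))
      step-diff f even = trans (cong (λ z → + z - + βcoeff f n) (βcoeff-step f even n)) (e (+ βcoeff f n) _)
    rat≡ : rat D (β (suc n) ⊖ β n) ≡ A (suc (2 ℕ.* k))
    rat≡ = trans (cong (rat D) diff≡) (rat-fromXi D _ _)
    q≡ : proj₂ (β (suc n) ⊖ β n) ≡ q (suc (2 ℕ.* k))
    q≡ = trans (cong proj₂ diff≡) (proj₂-fromXi _ _)

  β-recurrence : ∀ m → β m ⊕ β (suc (suc m)) ≡ scale (v D (+ suc m)) (β (suc m))
  β-recurrence m = trans (fromXi-⊕ D _ _ _ _) (trans (cong₂ (fromXi D)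
      (trans (cong +_ (βcoeff-recurrence (Pc D) Pc-even Pc-odd m)) (ℤₚ.pos-* (v D (+ suc m)) _))
      (trans (cong +_ (βcoeff-recurrence (Qc D) Qc-even Qc-odd m)) (ℤₚ.pos-* (v D (+ suc m)) _)))
    (sym (fromXi-· D (+ v D (+ suc m)) _ _)))

  β-recurrence₀ : conj D (β 1) ⊕ β 1 ≡ scale (v D (+ 0)) (β 0)
  β-recurrence₀ = trans (cong (λ z → conj D z ⊕ z) β₁≡) (sum≡ (a 0) (1≤a 0))
    where
    β₁≡ : β 1 ≡ fromXi D (+ suc (a 0)) 1ℤ
    β₁≡ = cong₂ (λ x y → fromXi D (+ x) (+ y)) (βcoeff-step (Pc D) Pc-even 0) (βcoeff-step (Qc D) Qc-even 0)
    sum≡ : ∀ x → 1 ℕ.≤ x → conj D (fromXi D (+ suc x) 1ℤ) ⊕ fromXi D (+ suc x) 1ℤ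
                             ≡ scale ((if oneMod4 D then 2 ℕ.* x ∸ 1 else 2 ℕ.* x) ℕ.+ 2) (fromXi D 1ℤ 0ℤ)
    sum≡ (suc x) _ with oneMod4 D
    ... | true = cong₂ _,_ (trans (e (+ x)) (cong (_* (1ℤ - 0ℤ)) (sym N≡))) (sym (ℤₚ.*-zeroʳ (+ (2 ℕ.* suc x ∸ 1 ℕ.+ 2))))
      where
      n : ∀ x → x ℕ.+ (suc x ℕ.+ 0) ℕ.+ 2 ≡ 2 ℕ.* x ℕ.+ 3
      n = ℕ-Ring.solve-∀
      N≡ : + (2 ℕ.* suc x ∸ 1 ℕ.+ 2) ≡ + 2 * + x + + 3
      N≡ = trans (cong +_ (n x)) (cong (_+ + 3) (ℤₚ.pos-* 2 x))
      e : ∀ X → + 2 + X - 1ℤ + 1ℤ + (+ 2 + X - 1ℤ) ≡ (+ 2 * X + + 3) * (1ℤ - 0ℤ)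
      e = solve-∀
    ... | false = cong₂ _,_ (trans (e (+ x)) (cong (_* 1ℤ) (sym N≡))) (sym (ℤₚ.*-zeroʳ (+ (2 ℕ.* suc x ℕ.+ 2))))
      where
      N≡ : + (2 ℕ.* suc x ℕ.+ 2) ≡ + 2 * (1ℤ + + x) + + 2
      N≡ = cong (_+ + 2) (ℤₚ.pos-* 2 (suc x))
      e : ∀ X → + 2 + X + (+ 2 + X) ≡ (+ 2 * (1ℤ + X) + + 2) * 1ℤ
      e = solve-∀

  consecutive-suc : ∀ n → Consecutive D (v D (+ suc n)) (β n) (β (suc n)) (β (suc (suc n)))
  consecutive-suc n = record
    { L⁺ = β-TotPos n
    ; B⁺ = β-TotPos (suc n)
    ; R⁺ = β-TotPos (suc (suc n))
    ; L⊕R = β-recurrence n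
    ; det≡1 = β-det (suc n)
    ; R⊖B = β-Mixed (suc n)
    ; B⊖L = β-Mixed n
    }

  consecutive : ∀ j → ∃₂ λ L R → Consecutive D (v D j) L (beta D j) R
  consecutive (+ zero) = conj D (β 1) , β 1 , record
    { L⁺ = TotPos-conj D (β 1) (β-TotPos 1)
    ; B⁺ = β-TotPos 0
    ; R⁺ = β-TotPos 1
    ; L⊕R = β-recurrence₀
    ; det≡1 = β-det 0
    ; R⊖B = β-Mixed 0
    ; B⊖L = subst (λ z → Mixed D (z ⊖ conj D (β 1))) conj-β₀ (Mixed-conj D (β 0) (β 1) (β-Mixed 0))
    }
    where
    conj-β₀ : conj D (β 0) ≡ β 0
    conj-β₀ with oneMod4 D
    ... | true = refl
    ... | false = refl
  consecutive (+ suc n) = β n , β (suc (suc n)) , consecutive-suc n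
  consecutive -[1+ m ] = conj D (β (suc (suc m))) , conj D (β m) , Consecutive-conj (consecutive-suc m)

lemma7p5 : (D : ℕ) → 2 ℕ.≤ D → SquareFree D → (j : ℤ) →
    (5 ℕ.≤ v D j → PartCount D (scale 4 (beta D j)) 5) ×
    (v D j ≡ 4 → PartCount D (scale 4 (beta D j)) 6) ×
    (v D j ≡ 3 → PartAtLeast D (scale 4 (beta D j)) 8) ×
    (v D j ≡ 2 → PartAtLeast D (scale 4 (beta D j)) 16)
lemma7p5 D 2≤D squareFree j with ContinuedFraction.consecutive 2≤D squareFree j
... | L , R , T =
  partCount≥5 T , (λ v≡4 → partCount₄ (at v≡4)) , (λ v≡3 → partAtLeast₃ (at v≡3)) , (λ v≡2 → partAtLeast₂ (at v≡2))
  where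
  at : ∀ {w} → v D j ≡ w → Consecutive D w L (beta D j) R
  at v≡w = subst (λ w → Consecutive D w L (beta D j) R) v≡w T
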